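{- The margin of $\Omega_{n,d}\subseteq(\mathbb{R}^n)^d$ is bounded as follows. (a) If $n=2$ and $d\geq 3$, then $\gamma(\Omega_{2,d})\leq 2^{ -\frac d2+1}$. (b) If $n\geq 3$ and $d=3$, then $\gamma(\Omega_{n,3})\leq 2^{ -n+1}$. (c) If $n\geq 3$ and $d=6r-3$ for some integer $r\geq 2$, then $$\gamma(\Omega_{n,d})\leq\frac{\sqrt6}{(n-1)\sqrt r}\,2^{ -r(n-1)+1}\leq 2^{ -r(n-1)+1}=2^{ -\frac{(d+3)(n-1)}{6}+1}.$$
   Context: For $i\in[n]$ let $\varepsilon_i:=e_i-\frac1n\mathbb{1}_n\in\mathbb{R}^n$, with $e_i$ the standard unit vector and $\mathbb{1}_n$ the all-ones vector. Let $\Omega_{n,d}:=\{(\varepsilon_{i_1},\dots,\varepsilon_{i_d}):i_1,\dots,i_d\in[n]\}\subseteq(\mathbb{R}^n)^d$. For a finite set $\Omega\subseteq\mathbb{R}^m$, its margin is $\gamma(\Omega):=\min\{\operatorname{dist}(0,\operatorname{conv}(S)): S\subseteq\Omega,\ 0\notin\operatorname{conv}(S)\}$.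
   Formalization: The ambient space $(\mathbb{R}^n)^d$ is replaced by (ℚ^n)^d, and the convex hulls in the margin γ are taken with rational weights. -}

module Defs where

open import Data.Nat using (ℕ; zero; suc)
open import Data.Fin using (Fin; zero; suc; _≟_)
open import Data.List using (List; length; lookup; map)
open import Data.Integer using (+_)
open import Data.Rational using (ℚ; 0ℚ; 1ℚ; _+_; _*_; _-_; _≤_; _/_)
open import Data.Product using (Σ; ∃; _×_)
open import Relation.Nullary using (¬_; does)
open import Relation.Binary.PropositionalEquality using (_≡_)
open import Data.Bool using (if_then_else_)

∑ : {k : ℕ} → (Fin k → ℚ) → ℚ
∑ {zero}  f = 0ℚ
∑ {suc k} f = f zero + ∑ (λ i → f (suc i))

ℕ→ℚ : ℕ → ℚ
ℕ→ℚ m = (+ m) / 1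

-- q / m for a natural m (only used with m > 0; m = 0 gives 0)
_/ℕ_ : ℚ → ℕ → ℚ
q /ℕ zero  = 0ℚ
q /ℕ suc m = q * ((+ 1) / suc m)

_^ℕ_ : ℚ → ℕ → ℚ
q ^ℕ zero  = 1ℚ
q ^ℕ suc m = q * (q ^ℕ m)

½ : ℚ
½ = (+ 1) / 2

-- points of (ℚ^n)^d, a rational model of (ℝ^n)^d
Pt : ℕ → ℕ → Set
Pt n d = Fin d → Fin n → ℚ

0pt : {n d : ℕ} → Pt n d
0pt _ _ = 0ℚ

‖_‖² : {n d : ℕ} → Pt n d → ℚ
‖ x ‖² = ∑ (λ j → ∑ (λ c → x j c * x j c))

ε : (n : ℕ) → Fin n → Fin n → ℚ
ε n i c = (if does (i ≟ c) then 1ℚ else 0ℚ) - (1ℚ /ℕ n)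

-- the element (ε_{i_1}, …, ε_{i_d}) of Ω_{n,d}
ωpt : {n d : ℕ} → (Fin d → Fin n) → Pt n d
ωpt {n} idx j = ε n (idx j)

InConv : {n d : ℕ} → List (Pt n d) → Pt n d → Set
InConv L x =
  Σ (Fin (length L) → ℚ) λ w →
    ((k : Fin (length L)) → 0ℚ ≤ w k) ×
    (∑ w ≡ 1ℚ) ×
    ((j : Fin _) (c : Fin _) → x j c ≡ ∑ (λ k → w k * lookup L k j c))

-- γ(Ω_{n,d}) ≤ B, stated via b = B² (B ≥ 0):
-- some S ⊆ Ω_{n,d} with 0 ∉ conv(S) has dist(0, conv(S))² ≤ b
-- (dist is attained, so: some point of conv(S) has squared norm ≤ b).
-- A subset S is given by a list of index tuples (i_1,…,i_d).
MarginSqAtMost : (n d : ℕ) → ℚ → Set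
MarginSqAtMost n d b =
  Σ (List (Fin d → Fin n)) λ S →
    (¬ InConv (map ωpt S) 0pt) ×
    (∃ λ x → InConv (map ωpt S) x × (‖ x ‖² ≤ b))

{-# OPTIONS --safe #-}
-- Call weights on tuples of Ω_{n,d} balanced at level K if, in every coordinate, every symbol carries
-- total weight K.  If a family S together with one more tuple Z of weight z is balanced, the normalised
-- average of S is −(z/(nK − z))·ε_Z, a point of conv(S) of squared norm (z/(nK − z))²·d(1 − 1/n); and
-- 0 ∉ conv(S) as soon as S carries no balanced weights of positive level.
--
-- For n = 2 such families are built by a Fibonacci recursion in d: the level is F_d, z = 1, and
-- 1/(2F_d − 1) ≤ 2^{1−d/2}.  For n ≥ 3 one first builds a chain of triples over N = rn symbols whose
-- weights double along the chain, with apex weight 2^{1−N}: it is balanced at level 1, and a linear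
-- functional vanishing on every triple but the apex shows that the rest of the chain is rigid.  Writing each
-- symbol as 2r − 1 digits in [n], every digit taking each value r times and the digit marginals
-- determining the symbol marginals, turns it into a family in Ω_{n,6r−3} with the same two properties.

module Submission where

open import Defs

module RationalArithmetic where

  open import Data.Nat as ℕ using (ℕ; zero; suc; z≤n; s≤s; _^_)
  import Data.Nat.Properties as ℕₚ
  import Data.Nat.Coprimality as Coprimality
  import Data.Integer as ℤ
  import Data.Integer.Properties as ℤₚ
  import Data.Sign as Sign
  open import Data.Rational using (ℚ; mkℚ; 0ℚ; 1ℚ; _+_; _*_; _-_; -_; _≤_; _<_; _/_; *≤*; *<*; nonNegative; positive)
  open import Data.Rational.Properties
  open import Relation.Nullary.Decidable using (dec⇒maybe)
  open import Relation.Binary.PropositionalEquality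
  open import Tactic.RingSolver using (solve-∀)
  open import Tactic.RingSolver.Core.AlmostCommutativeRing using (AlmostCommutativeRing; fromCommutativeRing)

  ℚring : AlmostCommutativeRing _ _
  ℚring = fromCommutativeRing +-*-commutativeRing (λ x → dec⇒maybe (0ℚ ≟ x))

  fromℕ : ℕ → ℚ
  fromℕ zero    = 0ℚ
  fromℕ (suc m) = 1ℚ + fromℕ m

  fromℕ-+ : ∀ a b → fromℕ (a ℕ.+ b) ≡ fromℕ a + fromℕ b
  fromℕ-+ zero    b = sym (+-identityˡ (fromℕ b))
  fromℕ-+ (suc a) b = trans (cong (1ℚ +_) (fromℕ-+ a b)) (sym (+-assoc 1ℚ (fromℕ a) (fromℕ b)))

  fromℕ-* : ∀ a b → fromℕ (a ℕ.* b) ≡ fromℕ a * fromℕ b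
  fromℕ-* zero    b = sym (*-zeroˡ (fromℕ b))
  fromℕ-* (suc a) b = begin
    fromℕ (b ℕ.+ a ℕ.* b)         ≡⟨ fromℕ-+ b (a ℕ.* b) ⟩
    fromℕ b + fromℕ (a ℕ.* b)     ≡⟨ cong (fromℕ b +_) (fromℕ-* a b) ⟩
    fromℕ b + fromℕ a * fromℕ b   ≡⟨ distrib (fromℕ a) (fromℕ b) ⟩
    (1ℚ + fromℕ a) * fromℕ b      ∎
    where
    open ≡-Reasoning
    distrib : ∀ x y → y + x * y ≡ (1ℚ + x) * y
    distrib = solve-∀ ℚring

  fromℕ-∸ : ∀ {a b} → a ℕ.≤ b → fromℕ (b ℕ.∸ a) ≡ fromℕ b - fromℕ a
  fromℕ-∸ {zero}  {b}     z≤n     = minus-zero (fromℕ b)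
    where
    minus-zero : ∀ x → x ≡ x - 0ℚ
    minus-zero = solve-∀ ℚring
  fromℕ-∸ {suc a} {suc b} (s≤s p) = trans (fromℕ-∸ p) (shift (fromℕ b) (fromℕ a))
    where
    shift : ∀ x y → x - y ≡ (1ℚ + x) - (1ℚ + y)
    shift = solve-∀ ℚring

  0<1 : 0ℚ < 1ℚ
  0<1 = *<* (ℤ.+<+ (s≤s z≤n))

  fromℕ-nonNeg : ∀ a → 0ℚ ≤ fromℕ a
  fromℕ-nonNeg zero    = ≤-refl
  fromℕ-nonNeg (suc a) = subst (_≤ 1ℚ + fromℕ a) (+-identityʳ 0ℚ) (+-mono-≤ (<⇒≤ 0<1) (fromℕ-nonNeg a))

  fromℕ-pos : ∀ {a} → 1 ℕ.≤ a → 0ℚ < fromℕ a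
  fromℕ-pos {suc a} _ = subst (_< 1ℚ + fromℕ a) (+-identityʳ 0ℚ) (+-mono-<-≤ 0<1 (fromℕ-nonNeg a))

  fromℕ-mono-≤ : ∀ {a b} → a ℕ.≤ b → fromℕ a ≤ fromℕ b
  fromℕ-mono-≤ {zero}  {b}     _       = fromℕ-nonNeg b
  fromℕ-mono-≤ {suc a} {suc b} (s≤s p) = +-monoʳ-≤ 1ℚ (fromℕ-mono-≤ p)

  fromℕ-*-≤ : ∀ {x y} {s} → x ℕ.≤ y → s ≤ 1ℚ → fromℕ x * s ≤ fromℕ y
  fromℕ-*-≤ {x} {y} {s} x≤y s≤1 = begin
    fromℕ x * s    ≤⟨ *-monoˡ-≤-nonNeg (fromℕ x) {{nonNegative (fromℕ-nonNeg x)}} s≤1 ⟩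
    fromℕ x * 1ℚ   ≡⟨ *-identityʳ (fromℕ x) ⟩
    fromℕ x        ≤⟨ fromℕ-mono-≤ x≤y ⟩
    fromℕ y        ∎
    where open ≤-Reasoning

  p≤q⇒0≤q-p : ∀ {p q} → p ≤ q → 0ℚ ≤ q - p
  p≤q⇒0≤q-p {p} {q} p≤q = subst (_≤ q - p) (+-inverseʳ p) (+-monoˡ-≤ (- p) p≤q)

  *-nonNeg : ∀ {a b} → 0ℚ ≤ a → 0ℚ ≤ b → 0ℚ ≤ a * b
  *-nonNeg {a} 0≤a 0≤b = subst (_≤ a * _) (*-zeroʳ a) (*-monoˡ-≤-nonNeg a {{nonNegative 0≤a}} 0≤b)

  *-pos : ∀ {a b} → 0ℚ < a → 0ℚ < b → 0ℚ < a * b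
  *-pos {a} 0<a 0<b = subst (_< a * _) (*-zeroʳ a) (*-monoʳ-<-pos a {{positive 0<a}} 0<b)

  private
    integer : ℕ → ℚ
    integer k = mkℚ (ℤ.+ k) 0 (Coprimality.sym (Coprimality.1-coprimeTo k))

    fromℕ≡integer : ∀ k → fromℕ k ≡ integer k
    fromℕ≡integer zero    = refl
    fromℕ≡integer (suc k) = begin
      1ℚ + fromℕ k      ≡⟨ cong (1ℚ +_) (fromℕ≡integer k) ⟩
      1ℚ + integer k    ≡⟨ /-cong {q₁ = 1} {p₂ = ℤ.+ suc k} {q₂ = 1} numerator refl ⟩
      (ℤ.+ suc k) / 1   ≡⟨ normalize-coprime (Coprimality.sym (Coprimality.1-coprimeTo (suc k))) ⟩
      integer (suc k)   ∎
      where
      open ≡-Reasoning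
      numerator : (ℤ.+ 1) ℤ.+ (Sign.+ ℤ.◃ (k ℕ.* 1)) ≡ ℤ.+ suc k
      numerator = trans (cong (λ z → (ℤ.+ 1) ℤ.+ z) (ℤₚ.+◃n≡+n (k ℕ.* 1))) (cong (λ z → ℤ.+ suc z) (ℕₚ.*-identityʳ k))

    1/ℕ-suc : ∀ k → 1ℚ /ℕ suc k ≡ mkℚ (ℤ.+ 1) k (Coprimality.1-coprimeTo (suc k))
    1/ℕ-suc k = trans (*-identityˡ _) (normalize-coprime (Coprimality.1-coprimeTo (suc k)))

  fromℕ*1/ℕ≡1 : ∀ {k} → 1 ℕ.≤ k → fromℕ k * (1ℚ /ℕ k) ≡ 1ℚ
  fromℕ*1/ℕ≡1 {suc k} _ = trans (cong₂ _*_ (fromℕ≡integer (suc k)) (1/ℕ-suc k)) (*-inverseʳ (integer (suc k)))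

  fromℕ-*-cancelˡ : ∀ k {x y} → fromℕ (suc k) * x ≡ fromℕ (suc k) * y → x ≡ y
  fromℕ-*-cancelˡ k {x} {y} eq = begin
    x                                      ≡⟨ sym (trans (cong (_* x) inverse) (*-identityˡ x)) ⟩
    (1ℚ /ℕ suc k * fromℕ (suc k)) * x      ≡⟨ *-assoc (1ℚ /ℕ suc k) _ x ⟩
    1ℚ /ℕ suc k * (fromℕ (suc k) * x)      ≡⟨ cong (1ℚ /ℕ suc k *_) eq ⟩
    1ℚ /ℕ suc k * (fromℕ (suc k) * y)      ≡⟨ sym (*-assoc (1ℚ /ℕ suc k) _ y) ⟩
    (1ℚ /ℕ suc k * fromℕ (suc k)) * y      ≡⟨ trans (cong (_* y) inverse) (*-identityˡ y) ⟩
    y                                      ∎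
    where
    open ≡-Reasoning
    inverse : 1ℚ /ℕ suc k * fromℕ (suc k) ≡ 1ℚ
    inverse = trans (*-comm (1ℚ /ℕ suc k) (fromℕ (suc k))) (fromℕ*1/ℕ≡1 {suc k} (s≤s z≤n))

  1/ℕ-nonNeg : ∀ k → 0ℚ ≤ 1ℚ /ℕ k
  1/ℕ-nonNeg zero    = ≤-refl
  1/ℕ-nonNeg (suc k) = subst (0ℚ ≤_) (sym (1/ℕ-suc k)) (*≤* (ℤ.+≤+ z≤n))

  1/ℕ-pos : ∀ k → 0ℚ < 1ℚ /ℕ suc k
  1/ℕ-pos k = subst (0ℚ <_) (sym (1/ℕ-suc k)) (*<* (ℤ.+<+ (s≤s z≤n)))

  /ℕ≡*1/ℕ : ∀ x {k} → 1 ℕ.≤ k → x /ℕ k ≡ x * (1ℚ /ℕ k)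
  /ℕ≡*1/ℕ x {suc k} _ = cong (x *_) (sym (*-identityˡ _))

  ½^*2^≡1 : ∀ k → ½ ^ℕ k * fromℕ (2 ^ k) ≡ 1ℚ
  ½^*2^≡1 zero    = refl
  ½^*2^≡1 (suc k) = begin
    (½ * ½ ^ℕ k) * fromℕ (2 ℕ.* 2 ^ k)          ≡⟨ cong ((½ * ½ ^ℕ k) *_) (fromℕ-* 2 (2 ^ k)) ⟩
    (½ * ½ ^ℕ k) * (fromℕ 2 * fromℕ (2 ^ k))    ≡⟨ regroup ½ (½ ^ℕ k) (fromℕ 2) (fromℕ (2 ^ k)) ⟩
    (½ * fromℕ 2) * (½ ^ℕ k * fromℕ (2 ^ k))    ≡⟨ cong ((½ * fromℕ 2) *_) (½^*2^≡1 k) ⟩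
    1ℚ * 1ℚ                                     ≡⟨⟩
    1ℚ                                          ∎
    where
    open ≡-Reasoning
    regroup : ∀ a b c d → (a * b) * (c * d) ≡ (a * c) * (b * d)
    regroup = solve-∀ ℚring

  ½^-pos : ∀ k → 0ℚ < ½ ^ℕ k
  ½^-pos zero    = 0<1
  ½^-pos (suc k) = *-pos 0<½ (½^-pos k)
    where
    0<½ : 0ℚ < ½
    0<½ = *<* (ℤ.+<+ (s≤s z≤n))

  1-1/ℕ≤1 : ∀ k → (1ℚ - 1ℚ /ℕ k) * fromℕ 1 ≤ 1ℚ
  1-1/ℕ≤1 k = begin
    (1ℚ - 1ℚ /ℕ k) * fromℕ 1   ≡⟨ one (1ℚ /ℕ k) ⟩
    1ℚ + - (1ℚ /ℕ k)           ≤⟨ +-monoʳ-≤ 1ℚ (neg-antimono-≤ (1/ℕ-nonNeg k)) ⟩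
    1ℚ + - 0ℚ                  ≡⟨⟩
    1ℚ                         ∎
    where
    open ≤-Reasoning
    one : ∀ u → (1ℚ - u) * (1ℚ + 0ℚ) ≡ 1ℚ + - u
    one = solve-∀ ℚring

  fromℕ*/ℕ-≤ : ∀ {a b k} {h} → 1 ℕ.≤ k → 0ℚ ≤ h → a ℕ.≤ b ℕ.* k → (fromℕ a * h) /ℕ k ≤ fromℕ b * h
  fromℕ*/ℕ-≤ {a} {b} {k} {h} k≥1 h≥0 a≤bk = begin
    (fromℕ a * h) /ℕ k                          ≡⟨ /ℕ≡*1/ℕ (fromℕ a * h) k≥1 ⟩
    (fromℕ a * h) * (1ℚ /ℕ k)                   ≤⟨ *-monoʳ-≤-nonNeg (1ℚ /ℕ k) {{nonNegative (1/ℕ-nonNeg k)}} ah≤bhk ⟩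
    (fromℕ b * h * fromℕ k) * (1ℚ /ℕ k)         ≡⟨ regroup (fromℕ b * h) (fromℕ k) (1ℚ /ℕ k) ⟩
    fromℕ b * h * (fromℕ k * (1ℚ /ℕ k))         ≡⟨ trans (cong (fromℕ b * h *_) (fromℕ*1/ℕ≡1 k≥1)) (*-identityʳ _) ⟩
    fromℕ b * h                                 ∎
    where
    open ≤-Reasoning
    regroup : ∀ x k u → (x * k) * u ≡ x * (k * u)
    regroup = solve-∀ ℚring
    ah≤bhk : fromℕ a * h ≤ fromℕ b * h * fromℕ k
    ah≤bhk = begin
      fromℕ a * h                 ≤⟨ *-monoʳ-≤-nonNeg h {{nonNegative h≥0}} (fromℕ-mono-≤ a≤bk) ⟩
      fromℕ (b ℕ.* k) * h         ≡⟨ cong (_* h) (fromℕ-* b k) ⟩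
      fromℕ b * fromℕ k * h       ≡⟨ swap (fromℕ b) (fromℕ k) h ⟩
      fromℕ b * h * fromℕ k       ∎
      where
      swap : ∀ b k h → b * k * h ≡ b * h * k
      swap = solve-∀ ℚring

module FiniteSums where

  open import Data.Nat as ℕ using (ℕ; zero; suc)
  import Data.Nat.Properties as ℕₚ
  open import Data.Fin using (Fin; zero; suc; toℕ)
  open import Data.List using (List; []; _∷_; map; _++_)
  open import Data.List.Properties using (map-∘)
  open import Data.List.Relation.Unary.All using (All; []; _∷_)
  open import Data.Product using (_×_; _,_; proj₁; proj₂; map₂)
  open import Data.Bool using (true; false; if_then_else_)
  open import Data.Empty using (⊥-elim)
  open import Function using (_∘_)
  open import Data.Rational using (ℚ; 0ℚ; 1ℚ; _+_; _*_; _-_; -_)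
  open import Data.Rational.Properties hiding (_≟_)
  open import Relation.Nullary using (does; yes; no; ¬_)
  open import Relation.Binary.Definitions using (DecidableEquality)
  open import Relation.Binary.PropositionalEquality
  open import Tactic.RingSolver using (solve-∀)

  open RationalArithmetic

  module Indicator {A : Set} (_≟_ : DecidableEquality A) where

    δ : A → A → ℚ
    δ a b = if does (a ≟ b) then 1ℚ else 0ℚ

    δ-refl : ∀ a → δ a a ≡ 1ℚ
    δ-refl a with a ≟ a
    ... | yes _  = refl
    ... | no a≢a = ⊥-elim (a≢a refl)

    δ-≢ : ∀ {a b} → ¬ a ≡ b → δ a b ≡ 0ℚ
    δ-≢ {a} {b} a≢b with a ≟ b
    ... | yes a≡b = ⊥-elim (a≢b a≡b)
    ... | no _    = refl

    δ-sym : ∀ a b → δ a b ≡ δ b a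
    δ-sym a b with a ≟ b | b ≟ a
    ... | yes _   | yes _   = refl
    ... | no _    | no _    = refl
    ... | yes a≡b | no b≢a  = ⊥-elim (b≢a (sym a≡b))
    ... | no a≢b  | yes b≡a = ⊥-elim (a≢b (sym b≡a))

    δ*δ : ∀ a b → δ a b * δ a b ≡ δ a b
    δ*δ a b with does (a ≟ b)
    ... | true  = refl
    ... | false = refl

  module _ {k : ℕ} where
    open Indicator (Data.Fin._≟_ {k}) public using (δ; δ*δ)

  open Indicator ℕ._≟_ public using () renaming (δ to δℕ; δ-refl to δℕ-refl; δ-≢ to δℕ-≢; δ-sym to δℕ-sym)

  δ-toℕ : ∀ {k} (a b : Fin k) → δ a b ≡ δℕ (toℕ a) (toℕ b)
  δ-toℕ zero    zero    = refl
  δ-toℕ zero    (suc b) = refl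
  δ-toℕ (suc a) zero    = refl
  δ-toℕ (suc a) (suc b) = δ-toℕ a b

  ∑-cong : ∀ {k} {f g : Fin k → ℚ} → (∀ i → f i ≡ g i) → ∑ f ≡ ∑ g
  ∑-cong {zero}  f≗g = refl
  ∑-cong {suc k} f≗g = cong₂ _+_ (f≗g zero) (∑-cong (f≗g ∘ suc))

  ∑-+ : ∀ {k} (f g : Fin k → ℚ) → ∑ (λ i → f i + g i) ≡ ∑ f + ∑ g
  ∑-+ {zero}  f g = refl
  ∑-+ {suc k} f g = trans (cong (f zero + g zero +_) (∑-+ (f ∘ suc) (g ∘ suc))) (+-interchange (f zero) (g zero) _ _)
    where
    +-interchange : ∀ a b c d → (a + b) + (c + d) ≡ (a + c) + (b + d)
    +-interchange = solve-∀ ℚring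

  ∑-*ˡ : ∀ {k} a (f : Fin k → ℚ) → ∑ (λ i → a * f i) ≡ a * ∑ f
  ∑-*ˡ {zero}  a f = sym (*-zeroʳ a)
  ∑-*ˡ {suc k} a f = trans (cong (a * f zero +_) (∑-*ˡ a (f ∘ suc))) (sym (*-distribˡ-+ a (f zero) _))

  ∑-const : ∀ k a → ∑ {k} (λ _ → a) ≡ fromℕ k * a
  ∑-const zero    a = sym (*-zeroˡ a)
  ∑-const (suc k) a = trans (cong (a +_) (∑-const k a)) (distrib (fromℕ k) a)
    where
    distrib : ∀ x a → a + x * a ≡ (1ℚ + x) * a
    distrib = solve-∀ ℚring

  ∑-δ : ∀ {k} (i : Fin k) (f : Fin k → ℚ) → ∑ (λ c → δ i c * f c) ≡ f i
  ∑-δ {suc k} zero f = begin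
    1ℚ * f zero + ∑ (λ c → 0ℚ * f (suc c))   ≡⟨ cong₂ _+_ (*-identityˡ (f zero)) (∑-cong (λ c → *-zeroˡ (f (suc c)))) ⟩
    f zero + ∑ {k} (λ _ → 0ℚ)                ≡⟨ cong (f zero +_) (trans (∑-const k 0ℚ) (*-zeroʳ (fromℕ k))) ⟩
    f zero + 0ℚ                              ≡⟨ +-identityʳ (f zero) ⟩
    f zero                                   ∎
    where open ≡-Reasoning
  ∑-δ {suc k} (suc i) f = trans (cong₂ _+_ (*-zeroˡ (f zero)) (∑-δ i (f ∘ suc))) (+-identityˡ (f (suc i)))

  ∑-δ≡1 : ∀ {k} (i : Fin k) → ∑ (δ i) ≡ 1ℚ
  ∑-δ≡1 i = trans (∑-cong (λ c → sym (*-identityʳ (δ i c)))) (∑-δ i (λ _ → 1ℚ))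

  ∑ℕ : ℕ → (ℕ → ℚ) → ℚ
  ∑ℕ zero    f = 0ℚ
  ∑ℕ (suc k) f = ∑ℕ k f + f k

  ∑ℕ-cong : ∀ k {f g : ℕ → ℚ} → (∀ i → i ℕ.< k → f i ≡ g i) → ∑ℕ k f ≡ ∑ℕ k g
  ∑ℕ-cong zero    f≗g = refl
  ∑ℕ-cong (suc k) f≗g = cong₂ _+_ (∑ℕ-cong k (λ i i<k → f≗g i (ℕₚ.m<n⇒m<1+n i<k))) (f≗g k ℕₚ.≤-refl)

  ∑ℕ-+ : ∀ k (f g : ℕ → ℚ) → ∑ℕ k (λ i → f i + g i) ≡ ∑ℕ k f + ∑ℕ k g
  ∑ℕ-+ zero    f g = sym (+-identityˡ 0ℚ)
  ∑ℕ-+ (suc k) f g = trans (cong (_+ (f k + g k)) (∑ℕ-+ k f g)) (+-interchange (∑ℕ k f) (∑ℕ k g) (f k) (g k))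
    where
    +-interchange : ∀ a b c d → (a + b) + (c + d) ≡ (a + c) + (b + d)
    +-interchange = solve-∀ ℚring

  ∑ℕ-*ˡ : ∀ k a (f : ℕ → ℚ) → ∑ℕ k (λ i → a * f i) ≡ a * ∑ℕ k f
  ∑ℕ-*ˡ zero    a f = sym (*-zeroʳ a)
  ∑ℕ-*ˡ (suc k) a f = trans (cong (_+ a * f k) (∑ℕ-*ˡ k a f)) (sym (*-distribˡ-+ a _ (f k)))

  ∑ℕ-neg : ∀ k (f : ℕ → ℚ) → ∑ℕ k (λ i → - f i) ≡ - ∑ℕ k f
  ∑ℕ-neg zero    f = refl
  ∑ℕ-neg (suc k) f = trans (cong (_+ - f k) (∑ℕ-neg k f)) (sym (neg-distrib-+ (∑ℕ k f) (f k)))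

  ∑ℕ-0 : ∀ k → ∑ℕ k (λ _ → 0ℚ) ≡ 0ℚ
  ∑ℕ-0 zero    = refl
  ∑ℕ-0 (suc k) = trans (+-identityʳ _) (∑ℕ-0 k)

  ∑ℕ-const : ∀ k a → ∑ℕ k (λ _ → a) ≡ fromℕ k * a
  ∑ℕ-const zero    a = sym (*-zeroˡ a)
  ∑ℕ-const (suc k) a = trans (cong (_+ a) (∑ℕ-const k a)) (distrib (fromℕ k) a)
    where
    distrib : ∀ x a → x * a + a ≡ (1ℚ + x) * a
    distrib = solve-∀ ℚring

  ∑ℕ-suc : ∀ k (f : ℕ → ℚ) → ∑ℕ (suc k) f ≡ f 0 + ∑ℕ k (f ∘ suc)
  ∑ℕ-suc zero    f = trans (+-identityˡ (f 0)) (sym (+-identityʳ (f 0)))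
  ∑ℕ-suc (suc k) f = trans (cong (_+ f (suc k)) (∑ℕ-suc k f)) (+-assoc (f 0) _ _)

  ∑ℕ-+-range : ∀ a b (f : ℕ → ℚ) → ∑ℕ (a ℕ.+ b) f ≡ ∑ℕ a f + ∑ℕ b (λ i → f (a ℕ.+ i))
  ∑ℕ-+-range a zero    f = trans (cong (λ m → ∑ℕ m f) (ℕₚ.+-identityʳ a)) (sym (+-identityʳ _))
  ∑ℕ-+-range a (suc b) f = begin
    ∑ℕ (a ℕ.+ suc b) f                                      ≡⟨ cong (λ m → ∑ℕ m f) (ℕₚ.+-suc a b) ⟩
    ∑ℕ (a ℕ.+ b) f + f (a ℕ.+ b)                            ≡⟨ cong (_+ f (a ℕ.+ b)) (∑ℕ-+-range a b f) ⟩
    (∑ℕ a f + ∑ℕ b (λ i → f (a ℕ.+ i))) + f (a ℕ.+ b)       ≡⟨ +-assoc (∑ℕ a f) _ _ ⟩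
    ∑ℕ a f + (∑ℕ b (λ i → f (a ℕ.+ i)) + f (a ℕ.+ b))       ∎
    where open ≡-Reasoning

  ∑ℕ-δ : ∀ k x (f : ℕ → ℚ) → x ℕ.< k → ∑ℕ k (λ i → δℕ i x * f i) ≡ f x
  ∑ℕ-δ (suc k) x f x<1+k with x ℕₚ.≟ k
  ... | yes refl = begin
    ∑ℕ x (λ i → δℕ i x * f i) + δℕ x x * f x  ≡⟨ cong₂ _+_ (∑ℕ-cong x (λ i i<x → trans (cong (_* f i) (δℕ-≢ (ℕₚ.<⇒≢ i<x))) (*-zeroˡ (f i)))) (cong (_* f x) (δℕ-refl x)) ⟩
    ∑ℕ x (λ _ → 0ℚ) + 1ℚ * f x                ≡⟨ cong₂ _+_ (∑ℕ-0 x) (*-identityˡ (f x)) ⟩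
    0ℚ + f x                                  ≡⟨ +-identityˡ (f x) ⟩
    f x                                       ∎
    where open ≡-Reasoning
  ... | no x≢k = begin
    ∑ℕ k (λ i → δℕ i x * f i) + δℕ k x * f k  ≡⟨ cong₂ _+_ (∑ℕ-δ k x f (ℕₚ.≤∧≢⇒< (ℕₚ.≤-pred x<1+k) x≢k)) (trans (cong (_* f k) (δℕ-≢ (x≢k ∘ sym))) (*-zeroˡ (f k))) ⟩
    f x + 0ℚ                                  ≡⟨ +-identityʳ (f x) ⟩
    f x                                       ∎
    where open ≡-Reasoning

  ∑ℕ-δ≡1 : ∀ k x → x ℕ.< k → ∑ℕ k (λ i → δℕ i x) ≡ 1ℚ
  ∑ℕ-δ≡1 k x x<k = trans (∑ℕ-cong k (λ i _ → sym (*-identityʳ (δℕ i x)))) (∑ℕ-δ k x (λ _ → 1ℚ) x<k)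

  ∑ℕ-telescope : ∀ k (G : ℕ → ℚ) → ∑ℕ k (λ i → G (suc i) - G i) ≡ G k - G 0
  ∑ℕ-telescope zero    G = sym (+-inverseʳ (G 0))
  ∑ℕ-telescope (suc k) G = trans (cong (_+ (G (suc k) - G k)) (∑ℕ-telescope k G)) (collapse (G (suc k)) (G k) (G 0))
    where
    collapse : ∀ a b c → (b - c) + (a - b) ≡ a - c
    collapse = solve-∀ ℚring

  wsum : {A : Set} → List (ℚ × A) → (A → ℚ) → ℚ
  wsum []             f = 0ℚ
  wsum ((w , a) ∷ WL) f = w * f a + wsum WL f

  weight : {A : Set} → List (ℚ × A) → ℚ
  weight WL = wsum WL (λ _ → 1ℚ)

  module _ {A : Set} where

    wsum-cong : ∀ (WL : List (ℚ × A)) {f g : A → ℚ} → (∀ a → f a ≡ g a) → wsum WL f ≡ wsum WL g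
    wsum-cong []             f≗g = refl
    wsum-cong ((w , a) ∷ WL) f≗g = cong₂ _+_ (cong (w *_) (f≗g a)) (wsum-cong WL f≗g)

    wsum-+ : ∀ (WL : List (ℚ × A)) f g → wsum WL (λ a → f a + g a) ≡ wsum WL f + wsum WL g
    wsum-+ []             f g = sym (+-identityˡ 0ℚ)
    wsum-+ ((w , a) ∷ WL) f g = trans (cong (w * (f a + g a) +_) (wsum-+ WL f g)) (distrib w (f a) (g a) _ _)
      where
      distrib : ∀ w x y s t → w * (x + y) + (s + t) ≡ (w * x + s) + (w * y + t)
      distrib = solve-∀ ℚring

    wsum-*ˡ : ∀ (WL : List (ℚ × A)) c f → wsum WL (λ a → c * f a) ≡ c * wsum WL f
    wsum-*ˡ []             c f = sym (*-zeroʳ c)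
    wsum-*ˡ ((w , a) ∷ WL) c f = trans (cong (w * (c * f a) +_) (wsum-*ˡ WL c f)) (distrib w c (f a) _)
      where
      distrib : ∀ w c x s → w * (c * x) + c * s ≡ c * (w * x + s)
      distrib = solve-∀ ℚring

    wsum-const : ∀ (WL : List (ℚ × A)) c → wsum WL (λ _ → c) ≡ c * weight WL
    wsum-const WL c = trans (wsum-cong WL (λ _ → sym (*-identityʳ c))) (wsum-*ˡ WL c (λ _ → 1ℚ))

    wsum-++ : ∀ (WL WL′ : List (ℚ × A)) f → wsum (WL ++ WL′) f ≡ wsum WL f + wsum WL′ f
    wsum-++ []             WL′ f = sym (+-identityˡ _)
    wsum-++ ((w , a) ∷ WL) WL′ f = trans (cong (w * f a +_) (wsum-++ WL WL′ f)) (sym (+-assoc (w * f a) _ _))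

    wsum-map₂ : ∀ {B : Set} (g : A → B) (WL : List (ℚ × A)) f → wsum (map (map₂ g) WL) f ≡ wsum WL (f ∘ g)
    wsum-map₂ g []             f = refl
    wsum-map₂ g ((w , a) ∷ WL) f = cong (w * f (g a) +_) (wsum-map₂ g WL f)

    wsum-vanishing : ∀ (WL : List (ℚ × A)) {f} → All (λ p → f (proj₂ p) ≡ 0ℚ) WL → wsum WL f ≡ 0ℚ
    wsum-vanishing []             []           = refl
    wsum-vanishing ((w , a) ∷ WL) (fa≡0 ∷ f≡0) = trans (cong₂ _+_ (trans (cong (w *_) fa≡0) (*-zeroʳ w)) (wsum-vanishing WL f≡0)) (+-identityˡ 0ℚ)

    wsum-∑ : ∀ {k} (WL : List (ℚ × A)) (f : A → Fin k → ℚ) → wsum WL (λ a → ∑ (f a)) ≡ ∑ (λ i → wsum WL (λ a → f a i))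
    wsum-∑ {k} []             f = sym (trans (∑-const k 0ℚ) (*-zeroʳ (fromℕ k)))
    wsum-∑ {k} ((w , a) ∷ WL) f = begin
      w * ∑ (f a) + wsum WL (λ a → ∑ (f a))                       ≡⟨ cong₂ _+_ (sym (∑-*ˡ w (f a))) (wsum-∑ WL f) ⟩
      ∑ (λ i → w * f a i) + ∑ (λ i → wsum WL (λ a → f a i))       ≡⟨ sym (∑-+ {k} _ _) ⟩
      ∑ (λ i → w * f a i + wsum WL (λ a → f a i))                 ∎
      where open ≡-Reasoning

    map-proj₂-map₂ : ∀ {B : Set} (f : A → B) (WL : List (ℚ × A)) → map proj₂ (map (map₂ f) WL) ≡ map f (map proj₂ WL)
    map-proj₂-map₂ f WL = trans (sym (map-∘ WL)) (map-∘ WL)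

    wsum-zero-weights : ∀ (WL : List (ℚ × A)) {f} → All (λ p → proj₁ p ≡ 0ℚ) WL → wsum WL f ≡ 0ℚ
    wsum-zero-weights []             []           = refl
    wsum-zero-weights ((w , a) ∷ WL) {f} (w≡0 ∷ ws≡0) =
      trans (cong₂ _+_ (trans (cong (_* f a) w≡0) (*-zeroˡ (f a))) (wsum-zero-weights WL ws≡0)) (+-identityˡ 0ℚ)

module TupleFamilies where

  open import Data.Nat as ℕ using (ℕ; zero; suc; z≤n; s≤s; _^_)
  import Data.Nat.Properties as ℕₚ
  open import Data.Fin using (Fin; zero; suc)
  open import Data.List using (List; []; _∷_; map; length; lookup)
  open import Data.List.Relation.Unary.All using (All; []; _∷_)
  open import Data.Product using (_×_; _,_; proj₁; proj₂)
  open import Data.Empty using (⊥)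
  open import Function using (_∘_)
  open import Data.Rational using (ℚ; 0ℚ; 1ℚ; _+_; _*_; _-_; -_; _≤_; _<_; positive)
  open import Data.Rational.Properties
  open import Relation.Nullary using (¬_)
  open import Relation.Binary.PropositionalEquality
  open import Tactic.RingSolver using (solve-∀)

  open RationalArithmetic
  open FiniteSums

  Tup : ℕ → ℕ → Set
  Tup n d = Fin d → Fin n

  module _ {n d : ℕ} where

    load : List (ℚ × Tup n d) → Fin d → Fin n → ℚ
    load WL j c = wsum WL (λ s → δ (s j) c)

    Balanced : ℚ → List (ℚ × Tup n d) → Set
    Balanced K WL = ∀ j c → load WL j c ≡ K

    weight-balanced : ∀ {K} (WL : List (ℚ × Tup n d)) → Balanced K WL → Fin d → weight WL ≡ fromℕ n * K
    weight-balanced {K} WL balanced j = begin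
      weight WL                           ≡⟨ wsum-cong WL (λ s → sym (∑-δ≡1 (s j))) ⟩
      wsum WL (λ s → ∑ (δ (s j)))         ≡⟨ wsum-∑ WL (λ s → δ (s j)) ⟩
      ∑ (load WL j)                       ≡⟨ ∑-cong (balanced j) ⟩
      ∑ {n} (λ _ → K)                     ≡⟨ ∑-const n K ⟩
      fromℕ n * K                         ∎
      where open ≡-Reasoning

    wsum-ε : ∀ (WL : List (ℚ × Tup n d)) j c → wsum WL (λ s → ε n (s j) c) ≡ load WL j c - (1ℚ /ℕ n) * weight WL
    wsum-ε WL j c = begin
      wsum WL (λ s → δ (s j) c + - u)          ≡⟨ wsum-+ WL (λ s → δ (s j) c) (λ _ → - u) ⟩
      load WL j c + wsum WL (λ _ → - u)        ≡⟨ cong (load WL j c +_) (wsum-const WL (- u)) ⟩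
      load WL j c + - u * weight WL            ≡⟨ cong (load WL j c +_) (sym (neg-distribˡ-* u (weight WL))) ⟩
      load WL j c - u * weight WL              ∎
      where
      open ≡-Reasoning
      u = 1ℚ /ℕ n

    attach : (S : List (Tup n d)) → (Fin (length (map ωpt S)) → ℚ) → List (ℚ × Tup n d)
    attach []      w = []
    attach (s ∷ S) w = (w zero , s) ∷ attach S (w ∘ suc)

    attach-tuples : ∀ S w → map proj₂ (attach S w) ≡ S
    attach-tuples []      w = refl
    attach-tuples (s ∷ S) w = cong (s ∷_) (attach-tuples S (w ∘ suc))

    ∑-attach : ∀ S w (f : Pt n d → ℚ) → ∑ (λ k → w k * f (lookup (map ωpt S) k)) ≡ wsum (attach S w) (f ∘ ωpt)
    ∑-attach []      w f = refl
    ∑-attach (s ∷ S) w f = cong (w zero * f (ωpt s) +_) (∑-attach S (w ∘ suc) f)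

    weightsOf : (WL : List (ℚ × Tup n d)) → Fin (length (map ωpt (map proj₂ WL))) → ℚ
    weightsOf ((w , _) ∷ WL) zero    = w
    weightsOf (_       ∷ WL) (suc k) = weightsOf WL k

    attach-weightsOf : ∀ WL → attach (map proj₂ WL) (weightsOf WL) ≡ WL
    attach-weightsOf []            = refl
    attach-weightsOf ((w , s) ∷ WL) = cong ((w , s) ∷_) (attach-weightsOf WL)

    weightsOf-nonNeg : ∀ WL → All (λ p → 0ℚ ≤ proj₁ p) WL → ∀ k → 0ℚ ≤ weightsOf WL k
    weightsOf-nonNeg (_ ∷ WL) (w≥0 ∷ _)   zero    = w≥0
    weightsOf-nonNeg (_ ∷ WL) (_ ∷ ws≥0) (suc k) = weightsOf-nonNeg WL ws≥0 k

  module _ {n d : ℕ} where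

    private
      N = suc n
      u = 1ℚ /ℕ N

    hull∌0 : ∀ (S : List (Tup N d)) → (∀ WL K → map proj₂ WL ≡ S → 0ℚ < K → Balanced K WL → ⊥) →
             ¬ InConv (map ωpt S) 0pt
    hull∌0 S rigid (w , _ , ∑w≡1 , 0≡∑) = rigid WL u (attach-tuples S w) (1/ℕ-pos n) balanced
      where
      WL = attach S w
      weight≡1 : weight WL ≡ 1ℚ
      weight≡1 = trans (sym (∑-attach S w (λ _ → 1ℚ))) (trans (∑-cong (λ k → *-identityʳ (w k))) ∑w≡1)
      balanced : Balanced u WL
      balanced j c = begin
        load WL j c                                  ≡⟨ solve-load (load WL j c) u (weight WL) ⟩
        (load WL j c - u * weight WL) + u * weight WL ≡⟨ cong₂ (λ x y → x + u * y) (sym (wsum-ε WL j c)) weight≡1 ⟩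
        wsum WL (λ s → ε N (s j) c) + u * 1ℚ          ≡⟨ cong (_+ u * 1ℚ) (trans (sym (∑-attach S w (λ P → P j c))) (sym (0≡∑ j c))) ⟩
        0ℚ + u * 1ℚ                                   ≡⟨ trans (+-identityˡ _) (*-identityʳ u) ⟩
        u                                             ∎
        where
        open ≡-Reasoning
        solve-load : ∀ l u w → l ≡ (l - u * w) + u * w
        solve-load = solve-∀ ℚring

    balanced-average : ∀ (R : List (ℚ × Tup N d)) (Z : Tup N d) {z K α : ℚ} →
                       Balanced K ((z , Z) ∷ R) → α * weight R ≡ 1ℚ →
                       ∀ j c → α * wsum R (λ s → ε N (s j) c) ≡ - (α * z) * ε N (Z j) c
    balanced-average R Z {z} {K} {α} balanced α*weight≡1 j c = begin
      α * wsum R (λ s → ε N (s j) c)                   ≡⟨ cong (α *_) (wsum-ε R j c) ⟩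
      α * (load R j c - u * W)                         ≡⟨ cong (λ l → α * (l - u * W)) load≡ ⟩
      α * ((K - z * D) - u * W)                        ≡⟨ expand α K z D u W (fromℕ N) ⟩
      - (α * z) * (D - u) + (α * K * (1ℚ - fromℕ N * u) + α * u * (fromℕ N * K - (z * 1ℚ + W)))
        ≡⟨ cong₂ (λ a b → - (α * z) * (D - u) + (α * K * (1ℚ - a) + α * u * (b - (z * 1ℚ + W))))
                 (fromℕ*1/ℕ≡1 {N} (s≤s z≤n)) (sym (weight-balanced ((z , Z) ∷ R) balanced j)) ⟩
      - (α * z) * (D - u) + (α * K * (1ℚ - 1ℚ) + α * u * ((z * 1ℚ + W) - (z * 1ℚ + W)))
        ≡⟨ cancel (- (α * z) * (D - u)) (α * K) (α * u) (z * 1ℚ + W) ⟩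
      - (α * z) * (D - u)                              ∎
      where
      open ≡-Reasoning
      W = weight R
      D = δ (Z j) c
      load≡ : load R j c ≡ K - z * D
      load≡ = trans (shift (load R j c) (z * D)) (cong (_- z * D) (balanced j c))
        where
        shift : ∀ l x → l ≡ (x + l) - x
        shift = solve-∀ ℚring
      expand : ∀ α K z D u W N → α * ((K - z * D) - u * W) ≡
               - (α * z) * (D - u) + (α * K * (1ℚ - N * u) + α * u * (N * K - (z * 1ℚ + W)))
      expand = solve-∀ ℚring
      cancel : ∀ x a b y → x + (a * (1ℚ - 1ℚ) + b * (y - y)) ≡ x
      cancel = solve-∀ ℚring

    hull-point : ∀ (R : List (ℚ × Tup N d)) (Z : Tup N d) {z K α : ℚ} →
                 All (λ p → 0ℚ ≤ proj₁ p) R → Balanced K ((z , Z) ∷ R) → α * weight R ≡ 1ℚ → 0ℚ ≤ α →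
                 InConv (map ωpt (map proj₂ R)) (λ j c → - (α * z) * ε N (Z j) c)
    hull-point R Z {z} {K} {α} R≥0 balanced α*weight≡1 α≥0 = w , w≥0 , ∑w≡1 , coordinates
      where
      L = map ωpt (map proj₂ R)
      w : Fin (length L) → ℚ
      w k = α * weightsOf R k
      w≥0 : ∀ k → 0ℚ ≤ w k
      w≥0 k = *-nonNeg α≥0 (weightsOf-nonNeg R R≥0 k)
      ∑-w : ∀ (f : Pt N d → ℚ) → ∑ (λ k → w k * f (lookup L k)) ≡ α * wsum R (f ∘ ωpt)
      ∑-w f = begin
        ∑ (λ k → w k * f (lookup L k))                          ≡⟨ ∑-cong (λ k → *-assoc α (weightsOf R k) _) ⟩
        ∑ (λ k → α * (weightsOf R k * f (lookup L k)))          ≡⟨ ∑-*ˡ α (λ k → weightsOf R k * f (lookup L k)) ⟩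
        α * ∑ (λ k → weightsOf R k * f (lookup L k))            ≡⟨ cong (α *_) (∑-attach (map proj₂ R) (weightsOf R) f) ⟩
        α * wsum (attach (map proj₂ R) (weightsOf R)) (f ∘ ωpt) ≡⟨ cong (λ WL → α * wsum WL (f ∘ ωpt)) (attach-weightsOf R) ⟩
        α * wsum R (f ∘ ωpt)                                    ∎
        where open ≡-Reasoning
      ∑w≡1 : ∑ w ≡ 1ℚ
      ∑w≡1 = trans (∑-cong (λ k → sym (*-identityʳ (w k)))) (trans (∑-w (λ _ → 1ℚ)) α*weight≡1)
      coordinates : ∀ j c → - (α * z) * ε N (Z j) c ≡ ∑ (λ k → w k * lookup L k j c)
      coordinates j c = sym (trans (∑-w (λ P → P j c)) (balanced-average R Z {z} {K} {α} balanced α*weight≡1 j c))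

    ∑ε² : ∀ (i : Fin N) → ∑ (λ c → ε N i c * ε N i c) ≡ 1ℚ - u
    ∑ε² i = begin
      ∑ (λ c → ε N i c * ε N i c)                                      ≡⟨ ∑-cong (λ c → square (δ i c) u) ⟩
      ∑ (λ c → (δ i c * δ i c + - (u + u) * δ i c) + u * u)            ≡⟨ ∑-+ (λ c → δ i c * δ i c + - (u + u) * δ i c) (λ _ → u * u) ⟩
      ∑ (λ c → δ i c * δ i c + - (u + u) * δ i c) + ∑ {N} (λ _ → u * u) ≡⟨ cong₂ _+_ (∑-+ (λ c → δ i c * δ i c) (λ c → - (u + u) * δ i c)) (∑-const N (u * u)) ⟩
      (∑ (λ c → δ i c * δ i c) + ∑ (λ c → - (u + u) * δ i c)) + fromℕ N * (u * u)
        ≡⟨ cong₂ (λ a b → (a + b) + fromℕ N * (u * u)) (∑-cong (δ*δ i)) (∑-*ˡ (- (u + u)) (δ i)) ⟩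
      (∑ (δ i) + - (u + u) * ∑ (δ i)) + fromℕ N * (u * u)              ≡⟨ cong (λ a → (a + - (u + u) * a) + fromℕ N * (u * u)) (∑-δ≡1 i) ⟩
      (1ℚ + - (u + u) * 1ℚ) + fromℕ N * (u * u)                        ≡⟨ cong ((1ℚ + - (u + u) * 1ℚ) +_) (trans (sym (*-assoc (fromℕ N) u u)) (cong (_* u) (fromℕ*1/ℕ≡1 {N} (s≤s z≤n)))) ⟩
      (1ℚ + - (u + u) * 1ℚ) + 1ℚ * u                                   ≡⟨ simplify u ⟩
      1ℚ - u                                                           ∎
      where
      open ≡-Reasoning
      square : ∀ x u → (x - u) * (x - u) ≡ (x * x + - (u + u) * x) + u * u
      square = solve-∀ ℚring
      simplify : ∀ u → (1ℚ + - (u + u) * 1ℚ) + 1ℚ * u ≡ 1ℚ - u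
      simplify = solve-∀ ℚring

    ‖*ε‖² : ∀ a (Z : Tup N d) → ‖ (λ j c → a * ε N (Z j) c) ‖² ≡ a * a * (fromℕ d * (1ℚ - u))
    ‖*ε‖² a Z = begin
      ∑ (λ j → ∑ (λ c → (a * ε N (Z j) c) * (a * ε N (Z j) c)))   ≡⟨ ∑-cong (λ j → ∑-cong (λ c → regroup a (ε N (Z j) c))) ⟩
      ∑ (λ j → ∑ (λ c → (a * a) * (ε N (Z j) c * ε N (Z j) c)))   ≡⟨ ∑-cong (λ j → trans (∑-*ˡ (a * a) (λ c → ε N (Z j) c * ε N (Z j) c)) (cong ((a * a) *_) (∑ε² (Z j)))) ⟩
      ∑ {d} (λ _ → (a * a) * (1ℚ - u))                             ≡⟨ ∑-const d _ ⟩
      fromℕ d * ((a * a) * (1ℚ - u))                               ≡⟨ regroup′ (fromℕ d) (a * a) (1ℚ - u) ⟩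
      a * a * (fromℕ d * (1ℚ - u))                                 ∎
      where
      open ≡-Reasoning
      regroup : ∀ a e → (a * e) * (a * e) ≡ (a * a) * (e * e)
      regroup = solve-∀ ℚring
      regroup′ : ∀ x y z → x * (y * z) ≡ y * (x * z)
      regroup′ = solve-∀ ℚring

  -- Certifies a bound for Ω_{suc n,d}: a nonempty alphabet makes the level 1/(suc n) of conv-weights positive.
  record MarginCertificate (n d : ℕ) : Set where
    field
      family        : List (ℚ × Tup (suc n) d)
      apex          : Tup (suc n) d
      apexWeight    : ℚ
      level         : ℚ
      scale         : ℚ
      family-nonNeg : All (λ p → 0ℚ ≤ proj₁ p) family
      balanced      : Balanced level ((apexWeight , apex) ∷ family)
      normalised    : scale * weight family ≡ 1ℚ
      scale-nonNeg  : 0ℚ ≤ scale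
      rigid         : ∀ WL K → map proj₂ WL ≡ map proj₂ family → 0ℚ < K → Balanced K WL → ⊥

    marginSq : ℚ
    marginSq = (scale * apexWeight) * (scale * apexWeight) * (fromℕ d * (1ℚ - 1ℚ /ℕ suc n))

  certificate⇒margin : ∀ {n d B} (C : MarginCertificate n d) → MarginCertificate.marginSq C ≤ B →
                       MarginSqAtMost (suc n) d B
  certificate⇒margin {n} {d} C marginSq≤B =
    map proj₂ family , hull∌0 (map proj₂ family) rigid ,
    (_ , hull-point family apex family-nonNeg balanced normalised scale-nonNeg , ≤-trans (≤-reflexive norm) marginSq≤B)
    where
    open MarginCertificate C
    a = scale * apexWeight
    norm : ‖ (λ j c → - a * ε (suc n) (apex j) c) ‖² ≡ marginSq
    norm = trans (‖*ε‖² (- a) apex) (cong (_* (fromℕ d * (1ℚ - 1ℚ /ℕ suc n))) (neg*neg a))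
      where
      neg*neg : ∀ a → - a * - a ≡ a * a
      neg*neg = solve-∀ ℚring

  inverse-square-bound : ∀ {a e m k q C} {t} → 1 ℕ.≤ e → 1 ℕ.≤ k → 1 ℕ.≤ q → t * fromℕ q ≤ 1ℚ →
                         a ℕ.* 2 ^ m ℕ.* k ℕ.≤ C ℕ.* (q ℕ.* (e ℕ.* e)) →
                         (1ℚ /ℕ e) * (1ℚ /ℕ e) * (fromℕ a * t) ≤ fromℕ C * ½ ^ℕ m * (1ℚ /ℕ k)
  inverse-square-bound {a} {e} {m} {k} {q} {C} {t} e≥1 k≥1 q≥1 tq≤1 apk≤Cqe² =
    *-cancelʳ-≤-pos c {{positive c>0}} (subst₂ _≤_ (sym lhs) (sym rhs) apk·tq≤Cqe²)
    where
    u = 1ℚ /ℕ e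
    w = 1ℚ /ℕ k
    h = ½ ^ℕ m
    A = fromℕ a
    E = fromℕ e
    P = fromℕ (2 ^ m)
    Kq = fromℕ k
    Q = fromℕ q
    c = (E * E) * (P * Kq) * Q
    c>0 : 0ℚ < c
    c>0 = *-pos (*-pos (*-pos (fromℕ-pos e≥1) (fromℕ-pos e≥1)) (*-pos (fromℕ-pos (ℕₚ.m^n>0 2 m)) (fromℕ-pos k≥1))) (fromℕ-pos q≥1)
    lhs : u * u * (A * t) * c ≡ (A * P * Kq) * (t * Q)
    lhs = begin
      u * u * (A * t) * c                       ≡⟨ regroup u A t E P Kq Q ⟩
      (E * u) * (E * u) * ((A * P * Kq) * (t * Q)) ≡⟨ cong (λ x → x * x * ((A * P * Kq) * (t * Q))) (fromℕ*1/ℕ≡1 e≥1) ⟩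
      1ℚ * 1ℚ * ((A * P * Kq) * (t * Q))        ≡⟨ *-identityˡ _ ⟩
      (A * P * Kq) * (t * Q)                    ∎
      where
      open ≡-Reasoning
      regroup : ∀ u A t E P K Q → u * u * (A * t) * ((E * E) * (P * K) * Q) ≡ (E * u) * (E * u) * ((A * P * K) * (t * Q))
      regroup = solve-∀ ℚring
    rhs : fromℕ C * h * w * c ≡ fromℕ C * (Q * (E * E))
    rhs = begin
      fromℕ C * h * w * c                        ≡⟨ regroup (fromℕ C) h w E P Kq Q ⟩
      (h * P) * (Kq * w) * (fromℕ C * (Q * (E * E))) ≡⟨ cong₂ (λ x y → x * y * (fromℕ C * (Q * (E * E)))) (½^*2^≡1 m) (fromℕ*1/ℕ≡1 k≥1) ⟩
      1ℚ * 1ℚ * (fromℕ C * (Q * (E * E)))        ≡⟨ *-identityˡ _ ⟩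
      fromℕ C * (Q * (E * E))                    ∎
      where
      open ≡-Reasoning
      regroup : ∀ C h w E P K Q → C * h * w * ((E * E) * (P * K) * Q) ≡ (h * P) * (K * w) * (C * (Q * (E * E)))
      regroup = solve-∀ ℚring
    apk·tq≤Cqe² : (A * P * Kq) * (t * Q) ≤ fromℕ C * (Q * (E * E))
    apk·tq≤Cqe² = subst₂ _≤_ (cong (_* (t * Q)) (trans (fromℕ-* (a ℕ.* 2 ^ m) k) (cong (_* Kq) (fromℕ-* a (2 ^ m)))))
                             (trans (fromℕ-* C _) (cong (fromℕ C *_) (trans (fromℕ-* q _) (cong (Q *_) (fromℕ-* e e)))))
                             (fromℕ-*-≤ apk≤Cqe² tq≤1)

module FibonacciFamily where

  open import Data.Nat as ℕ using (ℕ; zero; suc; z≤n; s≤s; _^_)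
  import Data.Nat.Properties as ℕₚ
  import Data.Nat.Tactic.RingSolver as ℕ-Solver
  open import Data.Fin using (Fin; zero; suc; opposite)
  open import Data.Fin.Patterns using (0F; 1F; 2F)
  open import Data.Vec.Functional using (tail) renaming (_∷_ to _◂_; [] to ◂[])
  open import Data.List using (List; []; _∷_; map)
  open import Data.List.Properties using (map-∘; map-id; ∷-injective)
  open import Data.List.Relation.Unary.All using (All; []; _∷_) renaming (head to All-head; tail to All-tail)
  import Data.List.Relation.Unary.All.Properties as All
  open import Data.Product using (_×_; _,_; proj₁; proj₂; map₂)
  open import Function using (_∘_)
  import Data.Integer as ℤ
  open import Data.Rational using (ℚ; 0ℚ; 1ℚ; _+_; _*_; _-_; -_; _≤_; _/_)
  open import Data.Rational.Properties
  open import Relation.Nullary.Decidable using (toWitness)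
  open import Relation.Binary.PropositionalEquality
  open import Tactic.RingSolver using (solve-∀)

  open RationalArithmetic
  open FiniteSums
  open TupleFamilies

  fib : ℕ → ℕ
  fib 0             = 0
  fib 1             = 1
  fib (suc (suc k)) = fib (suc k) ℕ.+ fib k

  fib-rec : ∀ k → fromℕ (fib (suc (suc k))) ≡ fromℕ (fib (suc k)) + fromℕ (fib k)
  fib-rec k = fromℕ-+ (fib (suc k)) (fib k)

  δ-opposite : ∀ (a c : Fin 2) → δ (opposite a) c ≡ 1ℚ - δ a c
  δ-opposite 0F 0F = refl
  δ-opposite 0F 1F = refl
  δ-opposite 1F 0F = refl
  δ-opposite 1F 1F = refl

  δ0+δ1 : ∀ (c : Fin 2) → δ 0F c + δ 1F c ≡ 1ℚ
  δ0+δ1 0F = refl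
  δ0+δ1 1F = refl

  fibPivot : ∀ m → Tup 2 (3 ℕ.+ m)
  fibPivot zero    = 0F ◂ 0F ◂ 1F ◂ ◂[]
  fibPivot (suc m) = 1F ◂ opposite ∘ fibPivot m

  fibApex : ∀ m → Tup 2 (3 ℕ.+ m)
  fibApex zero    = λ _ → 1F
  fibApex (suc m) = 0F ◂ fibApex m

  fibLevel : ℕ → ℚ
  fibLevel m = fromℕ (fib (3 ℕ.+ m))

  fibPivotWeight : ℕ → ℚ
  fibPivotWeight m = fromℕ (fib (suc m))

  fibOthers : ∀ m → List (ℚ × Tup 2 (3 ℕ.+ m))
  fibOthers zero    = (1ℚ , 0F ◂ 1F ◂ 0F ◂ ◂[]) ∷ (1ℚ , 1F ◂ 0F ◂ 0F ◂ ◂[]) ∷ []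
  fibOthers (suc m) = (fibLevel m , 1F ◂ fibPivot m) ∷ map (map₂ (0F ◂_)) (fibOthers m)

  fibFamily : ∀ m → List (ℚ × Tup 2 (3 ℕ.+ m))
  fibFamily m = (fibPivotWeight m , fibPivot m) ∷ fibOthers m

  module FibonacciStep (m : ℕ) (balanced : Balanced (fibLevel m) ((1ℚ , fibApex m) ∷ fibFamily m)) where

    q′ L : ℚ
    q′ = fibPivotWeight (suc m)
    L  = fibLevel m

    new-coordinate : ∀ c → load ((1ℚ , fibApex (suc m)) ∷ fibFamily (suc m)) zero c ≡ fibLevel (suc m)
    new-coordinate c = begin
      1ℚ * δ 0F c + (q′ * δ 1F c + (L * δ 1F c + wsum (map (map₂ (0F ◂_)) (fibOthers m)) (λ s → δ (s zero) c)))
        ≡⟨ cong (λ x → 1ℚ * δ 0F c + (q′ * δ 1F c + (L * δ 1F c + x)))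
                (trans (wsum-map₂ (0F ◂_) (fibOthers m) _) (wsum-const (fibOthers m) (δ 0F c))) ⟩
      1ℚ * δ 0F c + (q′ * δ 1F c + (L * δ 1F c + δ 0F c * weight (fibOthers m)))
        ≡⟨ arith (δ 0F c) (δ 1F c) (fibPivotWeight m) q′ L (weight (fibOthers m))
                 (δ0+δ1 c) (weight-balanced ((1ℚ , fibApex m) ∷ fibFamily m) balanced zero) (fib-rec (suc m)) ⟩
      L + q′
        ≡⟨ sym (fib-rec (suc (suc m))) ⟩
      fibLevel (suc m) ∎
      where
      open ≡-Reasoning
      arith : ∀ a b q q′ L W → a + b ≡ 1ℚ → 1ℚ * 1ℚ + (q * 1ℚ + W) ≡ (1ℚ + (1ℚ + 0ℚ)) * L → L ≡ q′ + q →
              1ℚ * a + (q′ * b + (L * b + a * W)) ≡ L + q′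
      arith a b q q′ _ W a+b≡1 total refl = begin
        1ℚ * a + (q′ * b + ((q′ + q) * b + a * W))
          ≡⟨ expand a b q q′ W ⟩
        (a + b) * ((q′ + q) + q′) + a * ((1ℚ * 1ℚ + (q * 1ℚ + W)) - (1ℚ + (1ℚ + 0ℚ)) * (q′ + q))
          ≡⟨ cong₂ (λ x y → x * ((q′ + q) + q′) + a * (y - (1ℚ + (1ℚ + 0ℚ)) * (q′ + q))) a+b≡1 total ⟩
        1ℚ * ((q′ + q) + q′) + a * ((1ℚ + (1ℚ + 0ℚ)) * (q′ + q) - (1ℚ + (1ℚ + 0ℚ)) * (q′ + q))
          ≡⟨ collapse a ((q′ + q) + q′) ((1ℚ + (1ℚ + 0ℚ)) * (q′ + q)) ⟩
        (q′ + q) + q′ ∎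
        where
        expand : ∀ a b q q′ W → 1ℚ * a + (q′ * b + ((q′ + q) * b + a * W)) ≡
                 (a + b) * ((q′ + q) + q′) + a * ((1ℚ * 1ℚ + (q * 1ℚ + W)) - (1ℚ + (1ℚ + 0ℚ)) * (q′ + q))
        expand = solve-∀ ℚring
        collapse : ∀ a x y → 1ℚ * x + a * (y - y) ≡ x
        collapse = solve-∀ ℚring

    old-coordinates : ∀ j c → load ((1ℚ , fibApex (suc m)) ∷ fibFamily (suc m)) (suc j) c ≡ fibLevel (suc m)
    old-coordinates j c = begin
      1ℚ * δ (fibApex m j) c + (q′ * δ (opposite (fibPivot m j)) c + (L * δ (fibPivot m j) c
        + wsum (map (map₂ (0F ◂_)) (fibOthers m)) (λ s → δ (s (suc j)) c)))
        ≡⟨ cong₂ (λ x y → 1ℚ * δ (fibApex m j) c + (q′ * x + (L * δ (fibPivot m j) c + y)))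
                 (δ-opposite (fibPivot m j) c) (wsum-map₂ (0F ◂_) (fibOthers m) _) ⟩
      1ℚ * δ (fibApex m j) c + (q′ * (1ℚ - δ (fibPivot m j) c) + (L * δ (fibPivot m j) c + load (fibOthers m) j c))
        ≡⟨ arith (δ (fibApex m j) c) (δ (fibPivot m j) c) (fibPivotWeight m) q′ L (load (fibOthers m) j c)
                 (balanced j c) (fib-rec (suc m)) ⟩
      L + q′
        ≡⟨ sym (fib-rec (suc (suc m))) ⟩
      fibLevel (suc m) ∎
      where
      open ≡-Reasoning
      arith : ∀ z p q q′ L X → 1ℚ * z + (q * p + X) ≡ L → L ≡ q′ + q → 1ℚ * z + (q′ * (1ℚ - p) + (L * p + X)) ≡ L + q′
      arith z p q q′ _ X old refl = trans (regroup z p q q′ X) (cong (_+ q′) old)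
        where
        regroup : ∀ z p q q′ X → 1ℚ * z + (q′ * (1ℚ - p) + ((q′ + q) * p + X)) ≡ (1ℚ * z + (q * p + X)) + q′
        regroup = solve-∀ ℚring

  fibFamily-balanced : ∀ m → Balanced (fibLevel m) ((1ℚ , fibApex m) ∷ fibFamily m)
  fibFamily-balanced zero    0F       0F = refl
  fibFamily-balanced zero    0F       1F = refl
  fibFamily-balanced zero    1F       0F = refl
  fibFamily-balanced zero    1F       1F = refl
  fibFamily-balanced zero    (suc 1F) 0F = refl
  fibFamily-balanced zero    (suc 1F) 1F = refl
  fibFamily-balanced (suc m) zero    c = FibonacciStep.new-coordinate m (fibFamily-balanced m) c
  fibFamily-balanced (suc m) (suc j) c = FibonacciStep.old-coordinates m (fibFamily-balanced m) j c

  drop-pivot-balanced : ∀ {d} (P : Tup 2 d) α β (WL₀ : List (ℚ × Tup 2 (suc d))) {K} →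
                        Balanced K ((α , 1F ◂ opposite ∘ P) ∷ (β , 1F ◂ P) ∷ WL₀) →
                        Balanced (K - α) ((β - α , P) ∷ map (map₂ tail) WL₀)
  drop-pivot-balanced P α β WL₀ {K} balanced j c = begin
    (β - α) * δ (P j) c + wsum (map (map₂ tail) WL₀) (λ s → δ (s j) c) ≡⟨ cong ((β - α) * δ (P j) c +_) (wsum-map₂ tail WL₀ (λ s → δ (s j) c)) ⟩
    (β - α) * δ (P j) c + X                                           ≡⟨ regroup α β (δ (P j) c) X ⟩
    (α * (1ℚ - δ (P j) c) + (β * δ (P j) c + X)) - α                  ≡⟨ cong (λ x → (α * x + (β * δ (P j) c + X)) - α) (sym (δ-opposite (P j) c)) ⟩
    (α * δ (opposite (P j)) c + (β * δ (P j) c + X)) - α              ≡⟨ cong (_- α) (balanced (suc j) c) ⟩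
    K - α                                                             ∎
    where
    open ≡-Reasoning
    X = load WL₀ (suc j) c
    regroup : ∀ α β p X → (β - α) * p + X ≡ (α * (1ℚ - p) + (β * p + X)) - α
    regroup = solve-∀ ℚring

  OnlyTrivialBalance : ∀ {n d} → List (Tup n d) → Set
  OnlyTrivialBalance {n} {d} S =
    ∀ (WL : List (ℚ × Tup n d)) {K} → map proj₂ WL ≡ S → Balanced K WL → K ≡ 0ℚ × All (λ p → proj₁ p ≡ 0ℚ) WL

  untail-tuples : ∀ m (WL₀ : List (ℚ × Tup 2 (4 ℕ.+ m))) → map proj₂ WL₀ ≡ map proj₂ (map (map₂ (0F ◂_)) (fibOthers m)) →
                  map proj₂ (map (map₂ tail) WL₀) ≡ map proj₂ (fibOthers m)
  untail-tuples m WL₀ tuples₀ = begin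
    map proj₂ (map (map₂ tail) WL₀)                           ≡⟨ map-proj₂-map₂ tail WL₀ ⟩
    map tail (map proj₂ WL₀)                                  ≡⟨ cong (map tail) tuples₀ ⟩
    map tail (map proj₂ (map (map₂ (0F ◂_)) (fibOthers m)))   ≡⟨ cong (map tail) (map-proj₂-map₂ (0F ◂_) (fibOthers m)) ⟩
    map tail (map (0F ◂_) (map proj₂ (fibOthers m)))          ≡⟨ sym (map-∘ (map proj₂ (fibOthers m))) ⟩
    map (tail ∘ (0F ◂_)) (map proj₂ (fibOthers m))            ≡⟨ map-id (map proj₂ (fibOthers m)) ⟩
    map proj₂ (fibOthers m)                                   ∎
    where open ≡-Reasoning

  zero-tail⇒level≡0 : ∀ {d} (P Q : Tup 2 d) α β (WL₀ : List (ℚ × Tup 2 (suc d))) {K} → All (λ p → proj₁ p ≡ 0ℚ) WL₀ →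
                      Balanced K ((α , 1F ◂ Q) ∷ (β , 1F ◂ P) ∷ WL₀) → K ≡ 0ℚ
  zero-tail⇒level≡0 P Q α β WL₀ {K} WL₀≡0 balanced = begin
    K                                                     ≡⟨ sym (balanced zero zero) ⟩
    α * 0ℚ + (β * 0ℚ + wsum WL₀ (λ s → δ (s zero) zero))  ≡⟨ cong (λ x → α * 0ℚ + (β * 0ℚ + x)) (wsum-zero-weights WL₀ WL₀≡0) ⟩
    α * 0ℚ + (β * 0ℚ + 0ℚ)                                ≡⟨ vanish α β ⟩
    0ℚ                                                    ∎
    where
    open ≡-Reasoning
    vanish : ∀ α β → α * 0ℚ + (β * 0ℚ + 0ℚ) ≡ 0ℚ
    vanish = solve-∀ ℚring

  fibFamily₀-rigid : OnlyTrivialBalance (map proj₂ (fibFamily 0))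
  fibFamily₀-rigid ((a , _) ∷ (b , _) ∷ (c , _) ∷ []) {K} refl balanced = K≡0 , a≡0 ∷ b≡0 ∷ c≡0 ∷ []
    where
    a≡K : a ≡ K
    a≡K = trans (pick₁ a b c) (balanced 2F 1F)
      where
      pick₁ : ∀ a b c → a ≡ a * 1ℚ + (b * 0ℚ + (c * 0ℚ + 0ℚ))
      pick₁ = solve-∀ ℚring
    b≡K : b ≡ K
    b≡K = trans (pick₂ a b c) (balanced 1F 1F)
      where
      pick₂ : ∀ a b c → b ≡ a * 0ℚ + (b * 1ℚ + (c * 0ℚ + 0ℚ))
      pick₂ = solve-∀ ℚring
    c≡K : c ≡ K
    c≡K = trans (pick₃ a b c) (balanced 0F 1F)
      where
      pick₃ : ∀ a b c → c ≡ a * 0ℚ + (b * 0ℚ + (c * 1ℚ + 0ℚ))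
      pick₃ = solve-∀ ℚring
    a+b≡K : a + b ≡ K
    a+b≡K = trans (pick₁₂ a b c) (balanced 0F 0F)
      where
      pick₁₂ : ∀ a b c → a + b ≡ a * 1ℚ + (b * 1ℚ + (c * 0ℚ + 0ℚ))
      pick₁₂ = solve-∀ ℚring
    K≡0 : K ≡ 0ℚ
    K≡0 = trans (cancel K) (trans (cong (_- K) (trans (cong₂ _+_ (sym a≡K) (sym b≡K)) a+b≡K)) (+-inverseʳ K))
      where
      cancel : ∀ K → K ≡ (K + K) - K
      cancel = solve-∀ ℚring
    a≡0 : a ≡ 0ℚ
    a≡0 = trans a≡K K≡0
    b≡0 : b ≡ 0ℚ
    b≡0 = trans b≡K K≡0
    c≡0 : c ≡ 0ℚ
    c≡0 = trans c≡K K≡0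

  fibFamily-rigid-step : ∀ m → OnlyTrivialBalance (map proj₂ (fibFamily m)) → OnlyTrivialBalance (map proj₂ (fibFamily (suc m)))
  fibFamily-rigid-step m IH ((α , s₁) ∷ (β , s₂) ∷ WL₀) {K} tuples balanced = K≡0 , α≡0 ∷ β≡0 ∷ WL₀≡0
    where
    P = fibPivot m
    s₁≡ : s₁ ≡ 1F ◂ opposite ∘ P
    s₁≡ = proj₁ (∷-injective tuples)
    s₂≡ : s₂ ≡ 1F ◂ P
    s₂≡ = proj₁ (∷-injective (proj₂ (∷-injective tuples)))
    balanced′ : Balanced K ((α , 1F ◂ opposite ∘ P) ∷ (β , 1F ◂ P) ∷ WL₀)
    balanced′ = subst₂ (λ s s′ → Balanced K ((α , s) ∷ (β , s′) ∷ WL₀)) s₁≡ s₂≡ balanced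
    dropped : K - α ≡ 0ℚ × All (λ p → proj₁ p ≡ 0ℚ) ((β - α , P) ∷ map (map₂ tail) WL₀)
    dropped = IH ((β - α , P) ∷ map (map₂ tail) WL₀) {K - α}
                 (cong (P ∷_) (untail-tuples m WL₀ (proj₂ (∷-injective (proj₂ (∷-injective tuples))))))
                 (drop-pivot-balanced P α β WL₀ balanced′)
    WL₀≡0 : All (λ p → proj₁ p ≡ 0ℚ) WL₀
    WL₀≡0 = All.map⁻ (All-tail (proj₂ dropped))
    K≡0 : K ≡ 0ℚ
    K≡0 = zero-tail⇒level≡0 P (opposite ∘ P) α β WL₀ WL₀≡0 balanced′
    α≡0 : α ≡ 0ℚ
    α≡0 = trans (recover K α) (cong₂ _-_ K≡0 (proj₁ dropped))
      where
      recover : ∀ K α → α ≡ K - (K - α)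
      recover = solve-∀ ℚring
    β≡0 : β ≡ 0ℚ
    β≡0 = trans (recover α β) (trans (cong₂ _+_ (All-head (proj₂ dropped)) α≡0) (+-identityʳ 0ℚ))
      where
      recover : ∀ α β → β ≡ (β - α) + α
      recover = solve-∀ ℚring

  fibFamily-rigid : ∀ m → OnlyTrivialBalance (map proj₂ (fibFamily m))
  fibFamily-rigid zero    = fibFamily₀-rigid
  fibFamily-rigid (suc m) = fibFamily-rigid-step m (fibFamily-rigid m)

  fibOthers-nonNeg : ∀ m → All (λ p → 0ℚ ≤ proj₁ p) (fibOthers m)
  fibOthers-nonNeg zero    = <⇒≤ 0<1 ∷ <⇒≤ 0<1 ∷ []
  fibOthers-nonNeg (suc m) = fromℕ-nonNeg (fib (3 ℕ.+ m)) ∷ All.map⁺ (fibOthers-nonNeg m)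

  fib-ratio : ∀ m → 3 ℕ.* fib (3 ℕ.+ m) ℕ.≤ 2 ℕ.* fib (4 ℕ.+ m)
  fib-ratio m = begin
    3 ℕ.* fib (3 ℕ.+ m)                                       ≡⟨ expand (fib (2 ℕ.+ m)) (fib (1 ℕ.+ m)) ⟩
    3 ℕ.* fib (2 ℕ.+ m) ℕ.+ 2 ℕ.* fib (1 ℕ.+ m) ℕ.+ fib (1 ℕ.+ m) ≤⟨ ℕₚ.+-monoʳ-≤ (3 ℕ.* fib (2 ℕ.+ m) ℕ.+ 2 ℕ.* fib (1 ℕ.+ m)) (fib-mono m) ⟩
    3 ℕ.* fib (2 ℕ.+ m) ℕ.+ 2 ℕ.* fib (1 ℕ.+ m) ℕ.+ fib (2 ℕ.+ m) ≡⟨ collect (fib (2 ℕ.+ m)) (fib (1 ℕ.+ m)) ⟩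
    2 ℕ.* fib (4 ℕ.+ m)                                       ∎
    where
    open ℕₚ.≤-Reasoning
    fib-mono : ∀ k → fib (suc k) ℕ.≤ fib (suc (suc k))
    fib-mono k = ℕₚ.m≤m+n (fib (suc k)) (fib k)
    expand : ∀ a b → 3 ℕ.* (a ℕ.+ b) ≡ 3 ℕ.* a ℕ.+ 2 ℕ.* b ℕ.+ b
    expand = ℕ-Solver.solve-∀
    collect : ∀ a b → 3 ℕ.* a ℕ.+ 2 ℕ.* b ℕ.+ a ≡ 2 ℕ.* ((a ℕ.+ b) ℕ.+ a)
    collect = ℕ-Solver.solve-∀

  fib²-growth : ∀ m → (3 ℕ.+ m) ℕ.* 2 ^ m ℕ.≤ fib (3 ℕ.+ m) ℕ.* fib (3 ℕ.+ m)
  fib²-growth 0 = toWitness {a? = 3 ℕ.* 2 ^ 0 ℕ.≤? fib 3 ℕ.* fib 3} _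
  fib²-growth 1 = toWitness {a? = 4 ℕ.* 2 ^ 1 ℕ.≤? fib 4 ℕ.* fib 4} _
  fib²-growth 2 = toWitness {a? = 5 ℕ.* 2 ^ 2 ℕ.≤? fib 5 ℕ.* fib 5} _
  fib²-growth 3 = toWitness {a? = 6 ℕ.* 2 ^ 3 ℕ.≤? fib 6 ℕ.* fib 6} _
  fib²-growth 4 = toWitness {a? = 7 ℕ.* 2 ^ 4 ℕ.≤? fib 7 ℕ.* fib 7} _
  fib²-growth 5 = toWitness {a? = 8 ℕ.* 2 ^ 5 ℕ.≤? fib 8 ℕ.* fib 8} _
  fib²-growth (suc m@(suc (suc (suc (suc (suc k)))))) = ℕₚ.*-cancelˡ-≤ 4 (begin
    4 ℕ.* ((4 ℕ.+ m) ℕ.* 2 ^ suc m)               ≡⟨ double (4 ℕ.+ m) (2 ^ m) ⟩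
    8 ℕ.* (4 ℕ.+ m) ℕ.* 2 ^ m                      ≤⟨ ℕₚ.*-monoˡ-≤ (2 ^ m) slack ⟩
    9 ℕ.* (3 ℕ.+ m) ℕ.* 2 ^ m                      ≡⟨ ℕₚ.*-assoc 9 (3 ℕ.+ m) (2 ^ m) ⟩
    9 ℕ.* ((3 ℕ.+ m) ℕ.* 2 ^ m)                    ≤⟨ ℕₚ.*-monoʳ-≤ 9 (fib²-growth m) ⟩
    9 ℕ.* (F ℕ.* F)                                ≡⟨ square 3 F ⟩
    (3 ℕ.* F) ℕ.* (3 ℕ.* F)                        ≤⟨ ℕₚ.*-mono-≤ (fib-ratio m) (fib-ratio m) ⟩
    (2 ℕ.* F′) ℕ.* (2 ℕ.* F′)                      ≡⟨ sym (square 2 F′) ⟩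
    4 ℕ.* (F′ ℕ.* F′)                              ∎)
    where
    open ℕₚ.≤-Reasoning
    F  = fib (3 ℕ.+ m)
    F′ = fib (4 ℕ.+ m)
    double : ∀ a x → 4 ℕ.* (a ℕ.* (2 ℕ.* x)) ≡ 8 ℕ.* a ℕ.* x
    double = ℕ-Solver.solve-∀
    square : ∀ c a → (c ℕ.* c) ℕ.* (a ℕ.* a) ≡ (c ℕ.* a) ℕ.* (c ℕ.* a)
    square = ℕ-Solver.solve-∀
    slack : 8 ℕ.* (4 ℕ.+ m) ℕ.≤ 9 ℕ.* (3 ℕ.+ m)
    slack = subst₂ ℕ._≤_ (sym (lhs k)) (sym (rhs k)) (ℕₚ.+-monoʳ-≤ 72 (ℕₚ.m≤m+n (8 ℕ.* k) k))
      where
      lhs : ∀ k → 8 ℕ.* (9 ℕ.+ k) ≡ 72 ℕ.+ 8 ℕ.* k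
      lhs = ℕ-Solver.solve-∀
      rhs : ∀ k → 9 ℕ.* (8 ℕ.+ k) ≡ 72 ℕ.+ (8 ℕ.* k ℕ.+ k)
      rhs = ℕ-Solver.solve-∀

  fib≥1 : ∀ m → 1 ℕ.≤ fib (suc m)
  fib≥1 zero    = s≤s z≤n
  fib≥1 (suc m) = ℕₚ.≤-trans (fib≥1 m) (ℕₚ.m≤m+n (fib (suc m)) (fib m))

  fibGap : ℕ → ℕ
  fibGap m = 2 ℕ.* fib (3 ℕ.+ m) ℕ.∸ 1

  fib≤fibGap : ∀ m → fib (3 ℕ.+ m) ℕ.≤ fibGap m
  fib≤fibGap m = begin
    F                        ≤⟨ ℕₚ.m≤m+n F (F ℕ.∸ 1) ⟩
    F ℕ.+ (F ℕ.∸ 1)          ≡⟨ sym (ℕₚ.+-∸-assoc F (fib≥1 (2 ℕ.+ m))) ⟩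
    (F ℕ.+ F) ℕ.∸ 1          ≡⟨ cong (ℕ._∸ 1) (cong (F ℕ.+_) (sym (ℕₚ.+-identityʳ F))) ⟩
    fibGap m                 ∎
    where
    open ℕₚ.≤-Reasoning
    F = fib (3 ℕ.+ m)

  fibFamily-weight : ∀ m → weight (fibFamily m) ≡ fromℕ (fibGap m)
  fibFamily-weight m = begin
    weight (fibFamily m)                        ≡⟨ shift (weight (fibFamily m)) ⟩
    (1ℚ * 1ℚ + weight (fibFamily m)) - 1ℚ       ≡⟨ cong (_- 1ℚ) (weight-balanced ((1ℚ , fibApex m) ∷ fibFamily m) (fibFamily-balanced m) zero) ⟩
    fromℕ 2 * fibLevel m - 1ℚ                   ≡⟨ cong (_- 1ℚ) (sym (fromℕ-* 2 (fib (3 ℕ.+ m)))) ⟩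
    fromℕ (2 ℕ.* fib (3 ℕ.+ m)) - 1ℚ            ≡⟨ sym (fromℕ-∸ (ℕₚ.≤-trans (fib≥1 (2 ℕ.+ m)) (ℕₚ.m≤m+n _ _))) ⟩
    fromℕ (fibGap m)                            ∎
    where
    open ≡-Reasoning
    shift : ∀ w → w ≡ (1ℚ * 1ℚ + w) - 1ℚ
    shift = solve-∀ ℚring

  fibCertificate : ∀ m → MarginCertificate 1 (3 ℕ.+ m)
  fibCertificate m = record
    { family        = fibFamily m
    ; apex          = fibApex m
    ; apexWeight    = 1ℚ
    ; level         = fibLevel m
    ; scale         = 1ℚ /ℕ fibGap m
    ; family-nonNeg = fromℕ-nonNeg (fib (suc m)) ∷ fibOthers-nonNeg m
    ; balanced      = fibFamily-balanced m
    ; normalised    = trans (cong (1ℚ /ℕ fibGap m *_) (fibFamily-weight m))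
                            (trans (*-comm (1ℚ /ℕ fibGap m) (fromℕ (fibGap m))) (fromℕ*1/ℕ≡1 (ℕₚ.≤-trans (fib≥1 (2 ℕ.+ m)) (fib≤fibGap m))))
    ; scale-nonNeg  = 1/ℕ-nonNeg (fibGap m)
    ; rigid         = λ WL K tuples K>0 balanced → <-irrefl (sym (proj₁ (fibFamily-rigid m WL tuples balanced))) K>0
    }

  fib-gap-bound : ∀ m → (3 ℕ.+ m) ℕ.* 2 ^ (3 ℕ.+ m) ℕ.* 1 ℕ.≤ 4 ℕ.* (2 ℕ.* (fibGap m ℕ.* fibGap m))
  fib-gap-bound m = begin
    (3 ℕ.+ m) ℕ.* 2 ^ (3 ℕ.+ m) ℕ.* 1     ≡⟨ eight (3 ℕ.+ m) (2 ^ m) ⟩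
    8 ℕ.* ((3 ℕ.+ m) ℕ.* 2 ^ m)           ≤⟨ ℕₚ.*-monoʳ-≤ 8 (fib²-growth m) ⟩
    8 ℕ.* (F ℕ.* F)                       ≤⟨ ℕₚ.*-monoʳ-≤ 8 (ℕₚ.*-mono-≤ (fib≤fibGap m) (fib≤fibGap m)) ⟩
    8 ℕ.* (e ℕ.* e)                       ≡⟨ ℕₚ.*-assoc 4 2 (e ℕ.* e) ⟩
    4 ℕ.* (2 ℕ.* (e ℕ.* e))               ∎
    where
    open ℕₚ.≤-Reasoning
    F = fib (3 ℕ.+ m)
    e = fibGap m
    eight : ∀ a x → a ℕ.* (2 ℕ.* (2 ℕ.* (2 ℕ.* x))) ℕ.* 1 ≡ 8 ℕ.* (a ℕ.* x)
    eight = ℕ-Solver.solve-∀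

  fibMargin : ∀ m → MarginSqAtMost 2 (3 ℕ.+ m) ((ℤ.+ 4 / 1) * ½ ^ℕ (3 ℕ.+ m))
  fibMargin m = certificate⇒margin (fibCertificate m) (begin
    (1ℚ /ℕ e * 1ℚ) * (1ℚ /ℕ e * 1ℚ) * (fromℕ d * (1ℚ - 1ℚ /ℕ 2))
      ≡⟨ cong (λ x → x * x * (fromℕ d * (1ℚ - 1ℚ /ℕ 2))) (*-identityʳ (1ℚ /ℕ e)) ⟩
    (1ℚ /ℕ e) * (1ℚ /ℕ e) * (fromℕ d * (1ℚ - 1ℚ /ℕ 2))
      ≤⟨ inverse-square-bound {d} {e} {d} {1} {2} {4} {1ℚ - 1ℚ /ℕ 2} e≥1 (s≤s z≤n) (s≤s z≤n) ≤-refl (fib-gap-bound m) ⟩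
    fromℕ 4 * ½ ^ℕ d * (1ℚ /ℕ 1)
      ≡⟨ *-identityʳ _ ⟩
    (ℤ.+ 4 / 1) * ½ ^ℕ d ∎)
    where
    open ≤-Reasoning
    d = 3 ℕ.+ m
    e = fibGap m
    e≥1 = ℕₚ.≤-trans (fib≥1 (2 ℕ.+ m)) (fib≤fibGap m)

  margin-bound-n≡2 : ∀ d → 3 ℕ.≤ d → MarginSqAtMost 2 d ((ℤ.+ 4 / 1) * ½ ^ℕ d)
  margin-bound-n≡2 1 (s≤s ())
  margin-bound-n≡2 2 (s≤s (s≤s ()))
  margin-bound-n≡2 (suc (suc (suc m))) _ = fibMargin m

module DoublingChain where

  open import Data.Nat as ℕ using (ℕ; zero; suc; z≤n; s≤s; _^_)
  import Data.Nat.Properties as ℕₚ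
  open import Data.Fin using (Fin)
  open import Data.Fin.Patterns using (0F; 1F; 2F)
  open import Data.Vec.Functional using () renaming (_∷_ to _◂_; [] to ◂[])
  open import Data.List using (List; []; _∷_; map; _++_)
  open import Data.List.Relation.Unary.All using (All; []; _∷_) renaming (tail to All-tail)
  import Data.List.Relation.Unary.All.Properties as All
  open import Data.Product using (_×_; _,_; proj₁; proj₂)
  open import Data.Empty using (⊥)
  open import Function using (_∘_)
  open import Data.Rational using (ℚ; 0ℚ; 1ℚ; _+_; _*_; _-_; -_; _≤_; _<_; nonNegative)
  open import Data.Rational.Properties
  open import Relation.Binary.PropositionalEquality
  open import Tactic.RingSolver using (solve-∀)

  open RationalArithmetic
  open FiniteSums

  Triple : Set
  Triple = Fin 3 → ℕ

  triple : ℕ → ℕ → ℕ → Triple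
  triple a b c = a ◂ b ◂ c ◂ ◂[]

  marginal : List (ℚ × Triple) → Fin 3 → ℕ → ℚ
  marginal WL j C = wsum WL (λ s → δℕ (s j) C)

  SymbolsBelow : ℕ → Triple → Set
  SymbolsBelow N s = ∀ j → s j ℕ.< N

  triple-below : ∀ {N a b c} → a ℕ.< N → b ℕ.< N → c ℕ.< N → SymbolsBelow N (triple a b c)
  triple-below a<N b<N c<N 0F = a<N
  triple-below a<N b<N c<N 1F = b<N
  triple-below a<N b<N c<N 2F = c<N

  wsum-via-marginal : ∀ N (WL : List (ℚ × Triple)) → All (SymbolsBelow N ∘ proj₂) WL → ∀ j (h : ℕ → ℚ) →
                      wsum WL (λ s → h (s j)) ≡ ∑ℕ N (λ C → h C * marginal WL j C)
  wsum-via-marginal N []             []           j h = sym (trans (∑ℕ-cong N (λ C _ → *-zeroʳ (h C))) (∑ℕ-0 N))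
  wsum-via-marginal N ((w , s) ∷ WL) (s<N ∷ WL<N) j h = begin
    w * h (s j) + wsum WL (λ s → h (s j))
      ≡⟨ cong₂ _+_ (cong (w *_) (sym (∑ℕ-δ N (s j) h (s<N j)))) (wsum-via-marginal N WL WL<N j h) ⟩
    w * ∑ℕ N (λ C → δℕ C (s j) * h C) + ∑ℕ N (λ C → h C * marginal WL j C)
      ≡⟨ cong (_+ ∑ℕ N (λ C → h C * marginal WL j C)) (sym (∑ℕ-*ˡ N w (λ C → δℕ C (s j) * h C))) ⟩
    ∑ℕ N (λ C → w * (δℕ C (s j) * h C)) + ∑ℕ N (λ C → h C * marginal WL j C)
      ≡⟨ sym (∑ℕ-+ N _ _) ⟩
    ∑ℕ N (λ C → w * (δℕ C (s j) * h C) + h C * marginal WL j C)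
      ≡⟨ ∑ℕ-cong N (λ C _ → trans (cong (λ x → w * (x * h C) + h C * marginal WL j C) (δℕ-sym C (s j)))
                                  (regroup w (δℕ (s j) C) (h C) (marginal WL j C))) ⟩
    ∑ℕ N (λ C → h C * (w * δℕ (s j) C + marginal WL j C)) ∎
    where
    open ≡-Reasoning
    regroup : ∀ w δ h m → w * (δ * h) + h * m ≡ h * (w * δ + m)
    regroup = solve-∀ ℚring

  -- A Farkas certificate for rest-rigid: it vanishes on every triple of the chain except the apex.
  halfPowers : ℕ → ℚ
  halfPowers 0             = ½
  halfPowers 1             = 0ℚ
  halfPowers (suc (suc C)) = ½ ^ℕ suc (suc C)

  separator : Fin 3 → ℕ → ℚ
  separator 0F C = - (½ ^ℕ C)
  separator 1F   = halfPowers
  separator 2F   = halfPowers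

  separate : Triple → ℚ
  separate s = separator 0F (s 0F) + (separator 1F (s 1F) + separator 2F (s 2F))

  module Chain (K : ℕ) where

    N : ℕ
    N = 2 ℕ.+ K

    b : ℚ
    b = ½ ^ℕ suc K

    x : ℕ → ℚ
    x k = fromℕ (2 ^ suc k) * b

    link : ℕ → List (ℚ × Triple)
    link k = (1ℚ - x k , triple (suc k) (2 ℕ.+ k) (2 ℕ.+ k))
           ∷ (x k      , triple (2 ℕ.+ k) (2 ℕ.+ k) 1)
           ∷ (x k      , triple (2 ℕ.+ k) 1 (2 ℕ.+ k))
           ∷ []

    links : ℕ → List (ℚ × Triple)
    links zero    = []
    links (suc k) = links k ++ link k

    apex : Triple
    apex = triple 0 1 1

    rest : List (ℚ × Triple)
    rest = (1ℚ - b , triple 0 0 0) ∷ (b , triple 1 1 0) ∷ (b , triple 1 0 1) ∷ links K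

    chain : List (ℚ × Triple)
    chain = (b , apex) ∷ rest

    x-suc : ∀ k → x (suc k) ≡ x k + x k
    x-suc k = begin
      fromℕ (2 ℕ.* 2 ^ suc k) * b          ≡⟨ cong (_* b) (fromℕ-* 2 (2 ^ suc k)) ⟩
      (fromℕ 2 * fromℕ (2 ^ suc k)) * b    ≡⟨ double (fromℕ (2 ^ suc k)) b ⟩
      x k + x k                            ∎
      where
      open ≡-Reasoning
      double : ∀ p b → ((1ℚ + (1ℚ + 0ℚ)) * p) * b ≡ p * b + p * b
      double = solve-∀ ℚring

    x0 : x 0 ≡ b + b
    x0 = double b
      where
      double : ∀ b → (1ℚ + (1ℚ + 0ℚ)) * b ≡ b + b
      double = solve-∀ ℚring

    xK : x K ≡ 1ℚ
    xK = trans (*-comm _ b) (½^*2^≡1 (suc K))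

    wsum-links : ∀ k f → wsum (links k) f ≡ ∑ℕ k (λ i → wsum (link i) f)
    wsum-links zero    f = refl
    wsum-links (suc k) f = trans (wsum-++ (links k) (link k) f) (cong (_+ wsum (link k) f) (wsum-links k f))

    ∑x : ∑ℕ K x ≡ 1ℚ - (b + b)
    ∑x = begin
      ∑ℕ K x                         ≡⟨ ∑ℕ-cong K (λ k _ → sym (trans (cong (_- x k) (x-suc k)) (cancel (x k)))) ⟩
      ∑ℕ K (λ k → x (suc k) - x k)   ≡⟨ ∑ℕ-telescope K x ⟩
      x K - x 0                      ≡⟨ cong₂ _-_ xK x0 ⟩
      1ℚ - (b + b)                   ∎
      where
      open ≡-Reasoning
      cancel : ∀ a → (a + a) - a ≡ a
      cancel = solve-∀ ℚring

    ∑ℕ-peel₂ : ∀ h → ∑ℕ N h ≡ h 0 + (h 1 + ∑ℕ K (λ k → h (2 ℕ.+ k)))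
    ∑ℕ-peel₂ h = trans (∑ℕ-suc (suc K) h) (cong (h 0 +_) (∑ℕ-suc K (h ∘ suc)))

    chain-uniform₀ : ∀ h → wsum chain (λ s → h (s 0F)) ≡ ∑ℕ N h
    chain-uniform₀ h = begin
      b * h 0 + ((1ℚ - b) * h 0 + (b * h 1 + (b * h 1 + wsum (links K) (λ s → h (s 0F)))))
        ≡⟨ cong (λ t → b * h 0 + ((1ℚ - b) * h 0 + (b * h 1 + (b * h 1 + t)))) links-sum ⟩
      b * h 0 + ((1ℚ - b) * h 0 + (b * h 1 + (b * h 1 + (A + (G K - G 0)))))
        ≡⟨ cong₂ (λ u v → b * h 0 + ((1ℚ - b) * h 0 + (b * h 1 + (b * h 1 + (A + (u * h (suc K) - v * h 1)))))) xK x0 ⟩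
      b * h 0 + ((1ℚ - b) * h 0 + (b * h 1 + (b * h 1 + (A + (1ℚ * h (suc K) - (b + b) * h 1)))))
        ≡⟨ collect b (h 0) (h 1) A (h (suc K)) ⟩
      h 0 + (A + h (suc K))
        ≡⟨ sym (∑ℕ-suc (suc K) h) ⟩
      ∑ℕ N h ∎
      where
      open ≡-Reasoning
      A = ∑ℕ K (h ∘ suc)
      G = λ k → x k * h (suc k)
      per-link : ∀ k → wsum (link k) (λ s → h (s 0F)) ≡ h (suc k) + (G (suc k) - G k)
      per-link k = trans (regroup (x k) (h (suc k)) (h (2 ℕ.+ k))) (cong (λ u → h (suc k) + (u * h (2 ℕ.+ k) - G k)) (sym (x-suc k)))
        where
        regroup : ∀ x p q → (1ℚ - x) * p + (x * q + (x * q + 0ℚ)) ≡ p + ((x + x) * q - x * p)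
        regroup = solve-∀ ℚring
      links-sum : wsum (links K) (λ s → h (s 0F)) ≡ A + (G K - G 0)
      links-sum = begin
        wsum (links K) (λ s → h (s 0F))                  ≡⟨ wsum-links K (λ s → h (s 0F)) ⟩
        ∑ℕ K (λ k → wsum (link k) (λ s → h (s 0F)))      ≡⟨ ∑ℕ-cong K (λ k _ → per-link k) ⟩
        ∑ℕ K (λ k → h (suc k) + (G (suc k) - G k))       ≡⟨ ∑ℕ-+ K (h ∘ suc) (λ k → G (suc k) - G k) ⟩
        A + ∑ℕ K (λ k → G (suc k) - G k)                 ≡⟨ cong (A +_) (∑ℕ-telescope K G) ⟩
        A + (G K - G 0)                                  ∎
      collect : ∀ b h₀ h₁ A h′ → b * h₀ + ((1ℚ - b) * h₀ + (b * h₁ + (b * h₁ + (A + (1ℚ * h′ - (b + b) * h₁))))) ≡ h₀ + (A + h′)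
      collect = solve-∀ ℚring

    side-links-sum : ∀ (h : ℕ → ℚ) (j : Fin 3) → (∀ k → wsum (link k) (λ s → h (s j)) ≡ h (2 ℕ.+ k) + h 1 * x k) →
                     wsum (links K) (λ s → h (s j)) ≡ ∑ℕ K (λ k → h (2 ℕ.+ k)) + h 1 * (1ℚ - (b + b))
    side-links-sum h j per-link = begin
      wsum (links K) (λ s → h (s j))                        ≡⟨ wsum-links K (λ s → h (s j)) ⟩
      ∑ℕ K (λ k → wsum (link k) (λ s → h (s j)))            ≡⟨ ∑ℕ-cong K (λ k _ → per-link k) ⟩
      ∑ℕ K (λ k → h (2 ℕ.+ k) + h 1 * x k)                  ≡⟨ ∑ℕ-+ K (λ k → h (2 ℕ.+ k)) (λ k → h 1 * x k) ⟩
      ∑ℕ K (λ k → h (2 ℕ.+ k)) + ∑ℕ K (λ k → h 1 * x k)     ≡⟨ cong (∑ℕ K (λ k → h (2 ℕ.+ k)) +_) (trans (∑ℕ-*ˡ K (h 1) x) (cong (h 1 *_) ∑x)) ⟩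
      ∑ℕ K (λ k → h (2 ℕ.+ k)) + h 1 * (1ℚ - (b + b))       ∎
      where open ≡-Reasoning

    chain-uniform₁ : ∀ h → wsum chain (λ s → h (s 1F)) ≡ ∑ℕ N h
    chain-uniform₁ h = begin
      b * h 1 + ((1ℚ - b) * h 0 + (b * h 1 + (b * h 0 + wsum (links K) (λ s → h (s 1F)))))
        ≡⟨ cong (λ t → b * h 1 + ((1ℚ - b) * h 0 + (b * h 1 + (b * h 0 + t)))) (side-links-sum h 1F per-link) ⟩
      b * h 1 + ((1ℚ - b) * h 0 + (b * h 1 + (b * h 0 + (B + h 1 * (1ℚ - (b + b))))))
        ≡⟨ collect b (h 0) (h 1) B ⟩
      h 0 + (h 1 + B)
        ≡⟨ sym (∑ℕ-peel₂ h) ⟩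
      ∑ℕ N h ∎
      where
      open ≡-Reasoning
      B = ∑ℕ K (λ k → h (2 ℕ.+ k))
      per-link : ∀ k → wsum (link k) (λ s → h (s 1F)) ≡ h (2 ℕ.+ k) + h 1 * x k
      per-link k = regroup (x k) (h (2 ℕ.+ k)) (h 1)
        where
        regroup : ∀ x p q → (1ℚ - x) * p + (x * p + (x * q + 0ℚ)) ≡ p + q * x
        regroup = solve-∀ ℚring
      collect : ∀ b h₀ h₁ B → b * h₁ + ((1ℚ - b) * h₀ + (b * h₁ + (b * h₀ + (B + h₁ * (1ℚ - (b + b)))))) ≡ h₀ + (h₁ + B)
      collect = solve-∀ ℚring

    chain-uniform₂ : ∀ h → wsum chain (λ s → h (s 2F)) ≡ ∑ℕ N h
    chain-uniform₂ h = begin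
      b * h 1 + ((1ℚ - b) * h 0 + (b * h 0 + (b * h 1 + wsum (links K) (λ s → h (s 2F)))))
        ≡⟨ cong (λ t → b * h 1 + ((1ℚ - b) * h 0 + (b * h 0 + (b * h 1 + t)))) (side-links-sum h 2F per-link) ⟩
      b * h 1 + ((1ℚ - b) * h 0 + (b * h 0 + (b * h 1 + (B + h 1 * (1ℚ - (b + b))))))
        ≡⟨ collect b (h 0) (h 1) B ⟩
      h 0 + (h 1 + B)
        ≡⟨ sym (∑ℕ-peel₂ h) ⟩
      ∑ℕ N h ∎
      where
      open ≡-Reasoning
      B = ∑ℕ K (λ k → h (2 ℕ.+ k))
      per-link : ∀ k → wsum (link k) (λ s → h (s 2F)) ≡ h (2 ℕ.+ k) + h 1 * x k
      per-link k = regroup (x k) (h (2 ℕ.+ k)) (h 1)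
        where
        regroup : ∀ x p q → (1ℚ - x) * p + (x * q + (x * p + 0ℚ)) ≡ p + q * x
        regroup = solve-∀ ℚring
      collect : ∀ b h₀ h₁ B → b * h₁ + ((1ℚ - b) * h₀ + (b * h₀ + (b * h₁ + (B + h₁ * (1ℚ - (b + b)))))) ≡ h₀ + (h₁ + B)
      collect = solve-∀ ℚring

    chain-uniform : ∀ j h → wsum chain (λ s → h (s j)) ≡ ∑ℕ N h
    chain-uniform 0F = chain-uniform₀
    chain-uniform 1F = chain-uniform₁
    chain-uniform 2F = chain-uniform₂

    rest-nonNeg : All (λ p → 0ℚ ≤ proj₁ p) rest
    rest-nonNeg = p≤q⇒0≤q-p b≤1 ∷ b≥0 ∷ b≥0 ∷ links-nonNeg K ℕₚ.≤-refl
      where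
      b≥0 : 0ℚ ≤ b
      b≥0 = <⇒≤ (½^-pos (suc K))
      scaled-b≤1 : ∀ {p} → p ℕ.≤ 2 ^ suc K → fromℕ p * b ≤ 1ℚ
      scaled-b≤1 p≤ = ≤-trans (*-monoʳ-≤-nonNeg b {{nonNegative b≥0}} (fromℕ-mono-≤ p≤)) (≤-reflexive xK)
      b≤1 : b ≤ 1ℚ
      b≤1 = subst (_≤ 1ℚ) (*-identityˡ b) (scaled-b≤1 (ℕₚ.m^n>0 2 (suc K)))
      x≥0 : ∀ k → 0ℚ ≤ x k
      x≥0 k = *-nonNeg (fromℕ-nonNeg (2 ^ suc k)) b≥0
      links-nonNeg : ∀ k → k ℕ.≤ K → All (λ p → 0ℚ ≤ proj₁ p) (links k)
      links-nonNeg zero    _      = []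
      links-nonNeg (suc k) 1+k≤K = All.++⁺ (links-nonNeg k (ℕₚ.<⇒≤ 1+k≤K))
        (p≤q⇒0≤q-p (scaled-b≤1 (ℕₚ.^-monoʳ-≤ 2 (s≤s (ℕₚ.<⇒≤ 1+k≤K)))) ∷ x≥0 k ∷ x≥0 k ∷ [])

    chain-below : All (SymbolsBelow N ∘ proj₂) chain
    chain-below = triple-below 0<N 1<N 1<N ∷ triple-below 0<N 0<N 0<N ∷ triple-below 1<N 1<N 0<N ∷ triple-below 1<N 0<N 1<N
                ∷ links-below K ℕₚ.≤-refl
      where
      0<N : 0 ℕ.< N
      0<N = s≤s z≤n
      1<N : 1 ℕ.< N
      1<N = s≤s (s≤s z≤n)
      links-below : ∀ k → k ℕ.≤ K → All (SymbolsBelow N ∘ proj₂) (links k)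
      links-below zero    _      = []
      links-below (suc k) 1+k≤K = All.++⁺ (links-below k (ℕₚ.<⇒≤ 1+k≤K))
        (triple-below k+1<N k+2<N k+2<N ∷ triple-below k+2<N k+2<N 1<N ∷ triple-below k+2<N 1<N k+2<N ∷ [])
        where
        k+2<N : 2 ℕ.+ k ℕ.< N
        k+2<N = s≤s (s≤s 1+k≤K)
        k+1<N : suc k ℕ.< N
        k+1<N = ℕₚ.<-trans (ℕₚ.n<1+n (suc k)) k+2<N

    rest-separated : All (λ p → separate (proj₂ p) ≡ 0ℚ) rest
    rest-separated = refl ∷ refl ∷ refl ∷ links-separated K
      where
      halves : ∀ k → - (½ ^ℕ suc k) + (½ ^ℕ suc (suc k) + ½ ^ℕ suc (suc k)) ≡ 0ℚ
      halves k = trans (cong (- (½ ^ℕ suc k) +_) (twice-half (½ ^ℕ suc k))) (+-inverseˡ (½ ^ℕ suc k))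
        where
        twice-half : ∀ x → ½ * x + ½ * x ≡ x
        twice-half x = trans (sym (*-distribʳ-+ x ½ ½)) (*-identityˡ x)
      cancel₁ : ∀ x → - x + (x + 0ℚ) ≡ 0ℚ
      cancel₁ = solve-∀ ℚring
      cancel₂ : ∀ x → - x + (0ℚ + x) ≡ 0ℚ
      cancel₂ = solve-∀ ℚring
      links-separated : ∀ k → All (λ p → separate (proj₂ p) ≡ 0ℚ) (links k)
      links-separated zero    = []
      links-separated (suc k) = All.++⁺ (links-separated k)
        (halves k ∷ cancel₁ (½ ^ℕ suc (suc k)) ∷ cancel₂ (½ ^ℕ suc (suc k)) ∷ [])

    ∑-separator : ∑ℕ N (separator 0F) + (∑ℕ N (separator 1F) + ∑ℕ N (separator 2F)) ≡ - b
    ∑-separator = begin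
      ∑ℕ N (separator 0F) + (∑ℕ N (separator 1F) + ∑ℕ N (separator 2F))
        ≡⟨ sym (cong₂ _+_ (chain-uniform 0F (separator 0F)) (cong₂ _+_ (chain-uniform 1F (separator 1F)) (chain-uniform 2F (separator 2F)))) ⟩
      wsum chain (λ s → separator 0F (s 0F)) + (wsum chain (λ s → separator 1F (s 1F)) + wsum chain (λ s → separator 2F (s 2F)))
        ≡⟨ sym (trans (wsum-+ chain _ _) (cong (wsum chain (λ s → separator 0F (s 0F)) +_) (wsum-+ chain _ _))) ⟩
      wsum chain separate
        ≡⟨ cong (b * separate apex +_) (wsum-vanishing rest rest-separated) ⟩
      b * separate apex + 0ℚ
        ≡⟨ minus-one b ⟩
      - b ∎
      where
      open ≡-Reasoning
      minus-one : ∀ b → b * (- 1ℚ + (0ℚ + 0ℚ)) + 0ℚ ≡ - b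
      minus-one = solve-∀ ℚring

    transport-tuples : ∀ {P : Triple → Set} (WL : List (ℚ × Triple)) → map proj₂ WL ≡ map proj₂ rest →
                       All (P ∘ proj₂) rest → All (P ∘ proj₂) WL
    transport-tuples {P} WL tuples = All.map⁻ ∘ subst (All P) (sym tuples) ∘ All.map⁺

    rest-rigid : ∀ (WL : List (ℚ × Triple)) c {κ} → map proj₂ WL ≡ map proj₂ rest → 0ℚ < κ →
                 (∀ j C → C ℕ.< N → c * marginal WL j C ≡ κ) → ⊥
    rest-rigid WL c {κ} tuples κ>0 uniform = <-irrefl (sym κb≡0) (*-pos κ>0 (½^-pos (suc K)))
      where
      open ≡-Reasoning
      c*wsum : ∀ j h → c * wsum WL (λ s → h (s j)) ≡ κ * ∑ℕ N h
      c*wsum j h = begin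
        c * wsum WL (λ s → h (s j))                      ≡⟨ cong (c *_) (wsum-via-marginal N WL (transport-tuples WL tuples (All-tail chain-below)) j h) ⟩
        c * ∑ℕ N (λ C → h C * marginal WL j C)           ≡⟨ sym (∑ℕ-*ˡ N c (λ C → h C * marginal WL j C)) ⟩
        ∑ℕ N (λ C → c * (h C * marginal WL j C))         ≡⟨ ∑ℕ-cong N (λ C C<N → trans (swap c (h C) (marginal WL j C)) (cong (h C *_) (uniform j C C<N))) ⟩
        ∑ℕ N (λ C → h C * κ)                             ≡⟨ ∑ℕ-cong N (λ C _ → *-comm (h C) κ) ⟩
        ∑ℕ N (λ C → κ * h C)                             ≡⟨ ∑ℕ-*ˡ N κ h ⟩
        κ * ∑ℕ N h                                       ∎
        where
        swap : ∀ a b c → a * (b * c) ≡ b * (a * c)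
        swap = solve-∀ ℚring
      κb≡0 : κ * b ≡ 0ℚ
      κb≡0 = begin
        κ * b                                            ≡⟨ negate κ b ⟩
        - (κ * - b)                                      ≡⟨ cong (λ t → - (κ * t)) (sym ∑-separator) ⟩
        - (κ * (S 0F + (S 1F + S 2F)))                   ≡⟨ cong -_ (distrib κ (S 0F) (S 1F) (S 2F)) ⟩
        - (κ * S 0F + (κ * S 1F + κ * S 2F))             ≡⟨ cong -_ (sym (cong₂ _+_ (c*wsum 0F (separator 0F)) (cong₂ _+_ (c*wsum 1F (separator 1F)) (c*wsum 2F (separator 2F))))) ⟩
        - (c * W 0F + (c * W 1F + c * W 2F))             ≡⟨ cong -_ (sym (distrib c (W 0F) (W 1F) (W 2F))) ⟩
        - (c * (W 0F + (W 1F + W 2F)))                   ≡⟨ cong (λ t → - (c * t)) (sym (trans (wsum-+ WL _ _) (cong (W 0F +_) (wsum-+ WL _ _)))) ⟩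
        - (c * wsum WL separate)                         ≡⟨ cong (λ t → - (c * t)) (wsum-vanishing WL (transport-tuples WL tuples rest-separated)) ⟩
        - (c * 0ℚ)                                       ≡⟨ cong -_ (*-zeroʳ c) ⟩
        0ℚ                                               ∎
        where
        S = λ j → ∑ℕ N (separator j)
        W = λ j → wsum WL (λ s → separator j (s j))
        negate : ∀ κ b → κ * b ≡ - (κ * - b)
        negate = solve-∀ ℚring
        distrib : ∀ a x y z → a * (x + (y + z)) ≡ a * x + (a * y + a * z)
        distrib = solve-∀ ℚring

module DigitCodes where

  open import Data.Nat as ℕ using (ℕ; zero; suc; z≤n; s≤s; _/_; _%_; _≡ᵇ_)
  import Data.Nat.Properties as ℕₚ
  import Data.Nat.DivMod as DivMod
  open import Data.Nat.Divisibility using (n∣m*n)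
  open import Data.Bool using (true; false; if_then_else_)
  open import Data.Sum using (_⊎_; inj₁; inj₂)
  open import Function using (_∘_)
  open import Data.Empty using (⊥-elim)
  open import Data.Rational using (ℚ; 0ℚ; 1ℚ; _+_; _*_; _-_; -_)
  open import Data.Rational.Properties
  open import Algebra.Properties.Group +-0-group using () renaming (∙-cancelˡ to +-cancelˡ)
  open import Relation.Nullary using (¬_; Dec; yes; no)
  open import Relation.Binary.PropositionalEquality
  open import Tactic.RingSolver using (solve-∀)

  open RationalArithmetic
  open FiniteSums

  ≡ᵇ-refl : ∀ m → (m ≡ᵇ m) ≡ true
  ≡ᵇ-refl zero    = refl
  ≡ᵇ-refl (suc m) = ≡ᵇ-refl m

  ≢⇒≡ᵇ-false : ∀ {m k} → ¬ m ≡ k → (m ≡ᵇ k) ≡ false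
  ≢⇒≡ᵇ-false {zero}  {zero}  m≢k = ⊥-elim (m≢k refl)
  ≢⇒≡ᵇ-false {zero}  {suc k} _   = refl
  ≢⇒≡ᵇ-false {suc m} {zero}  _   = refl
  ≢⇒≡ᵇ-false {suc m} {suc k} m≢k = ≢⇒≡ᵇ-false (m≢k ∘ cong suc)

  -- A symbol C < R·n is position C % n of block C / n.  Digit 0 is the position; on block q ≥ 1,
  -- digit 2q − 1 cycles the positions and digit 2q merges position 1 into 0 (it also sends C = 0 to 1).
  module DigitCode (n′ : ℕ) where

    n : ℕ
    n = suc (suc n′)

    cycle : ℕ → ℕ
    cycle t = if suc t ≡ᵇ n then 0 else suc t

    merge : ℕ → ℕ
    merge 0             = 0
    merge 1             = 0
    merge (suc (suc t)) = suc (suc t)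

    data Kind : Set where
      plain         : Kind
      cycled merged : ℕ → Kind

    digitOf : Kind → ℕ → ℕ
    digitOf plain      C = C % n
    digitOf (cycled q) C = if C / n ≡ᵇ q then cycle (C % n) else C % n
    digitOf (merged q) C = if C ≡ᵇ 0 then 1 else (if C / n ≡ᵇ q then merge (C % n) else C % n)

    nextBlock : Kind → Kind
    nextBlock plain      = plain
    nextBlock (cycled q) = cycled (suc q)
    nextBlock (merged q) = merged (suc q)

    blockKind : ℕ → Kind
    blockKind 0             = cycled 1
    blockKind 1             = merged 1
    blockKind (suc (suc i)) = nextBlock (blockKind i)

    kind : ℕ → Kind
    kind 0       = plain
    kind (suc i) = blockKind i

    digit : ℕ → ℕ → ℕ
    digit i = digitOf (kind i)

    cycle<n : ∀ {t} → t ℕ.< n → cycle t ℕ.< n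
    cycle<n {t} t<n with suc t ℕₚ.≟ n
    ... | yes 1+t≡n = subst (λ b → (if b then 0 else suc t) ℕ.< n) (sym (trans (cong (suc t ≡ᵇ_) (sym 1+t≡n)) (≡ᵇ-refl (suc t)))) (s≤s z≤n)
    ... | no 1+t≢n  = subst (λ b → (if b then 0 else suc t) ℕ.< n) (sym (≢⇒≡ᵇ-false 1+t≢n)) (ℕₚ.≤∧≢⇒< t<n 1+t≢n)

    merge≤ : ∀ t → merge t ℕ.≤ t
    merge≤ 0             = z≤n
    merge≤ 1             = z≤n
    merge≤ (suc (suc t)) = ℕₚ.≤-refl

    digit<n : ∀ i C → digit i C ℕ.< n
    digit<n i C = digitOf<n (kind i)
      where
      C%n<n : C % n ℕ.< n
      C%n<n = DivMod.m%n<n C n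
      if< : ∀ b {x y} → x ℕ.< n → y ℕ.< n → (if b then x else y) ℕ.< n
      if< true  x<n _   = x<n
      if< false _   y<n = y<n
      digitOf<n : ∀ k → digitOf k C ℕ.< n
      digitOf<n plain      = C%n<n
      digitOf<n (cycled q) = if< (C / n ≡ᵇ q) (cycle<n C%n<n) C%n<n
      digitOf<n (merged q) = if< (C ≡ᵇ 0) (s≤s (s≤s z≤n)) (if< (C / n ≡ᵇ q) (ℕₚ.≤-<-trans (merge≤ (C % n)) C%n<n) C%n<n)

    block-% : ∀ R {t} → t ℕ.< n → (t ℕ.+ R ℕ.* n) % n ≡ t
    block-% R {t} t<n = trans (DivMod.[m+kn]%n≡m%n t R n) (DivMod.m<n⇒m%n≡m t<n)

    block-/ : ∀ R {t} → t ℕ.< n → (t ℕ.+ R ℕ.* n) / n ≡ R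
    block-/ R {t} t<n = trans (DivMod.+-distrib-/-∣ʳ t (n∣m*n R)) (cong₂ ℕ._+_ (DivMod.m<n⇒m/n≡0 t<n) (DivMod.m*n/n≡m R n))

    block-≢0 : ∀ r′ t → ¬ t ℕ.+ suc r′ ℕ.* n ≡ 0
    block-≢0 r′ t eq = ℕₚ.<⇒≢ (ℕₚ.<-≤-trans (s≤s z≤n) (ℕₚ.m≤n+m (suc r′ ℕ.* n) t)) (sym eq)

    half : ℕ → ℕ
    half 0             = 0
    half 1             = 0
    half (suc (suc i)) = suc (half i)

    blockKind-block : ∀ i → blockKind i ≡ cycled (suc (half i)) ⊎ blockKind i ≡ merged (suc (half i))
    blockKind-block 0             = inj₁ refl
    blockKind-block 1             = inj₂ refl
    blockKind-block (suc (suc i)) with blockKind-block i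
    ... | inj₁ eq = inj₁ (cong nextBlock eq)
    ... | inj₂ eq = inj₂ (cong nextBlock eq)

    half< : ∀ i r → suc i ℕ.≤ r ℕ.+ r → half i ℕ.< r
    half< 0             (suc r) _       = s≤s z≤n
    half< 1             (suc r) _       = s≤s z≤n
    half< (suc (suc i)) (suc r) (s≤s p) = s≤s (half< i r (ℕₚ.≤-pred (subst (suc (suc i) ℕ.≤_) (ℕₚ.+-suc r r) p)))

    blockKind-cycled : ∀ r → blockKind (r ℕ.+ r) ≡ cycled (suc r)
    blockKind-cycled zero    = refl
    blockKind-cycled (suc r) = trans (cong (blockKind ∘ suc) (ℕₚ.+-suc r r)) (cong nextBlock (blockKind-cycled r))

    blockKind-merged : ∀ r → blockKind (suc (r ℕ.+ r)) ≡ merged (suc r)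
    blockKind-merged zero    = refl
    blockKind-merged (suc r) = trans (cong (blockKind ∘ suc ∘ suc) (ℕₚ.+-suc r r)) (cong nextBlock (blockKind-merged r))

    module NewBlock (r′ : ℕ) where

      R M : ℕ
      R = suc r′
      M = R ℕ.* n

      different : ∀ {i} → suc i ℕ.≤ r′ ℕ.+ r′ → ¬ R ≡ suc (half i)
      different {i} i< R≡ = ℕₚ.<-irrefl (sym (ℕₚ.suc-injective R≡)) (half< i r′ i<)

      old-digit-on-new-block : ∀ i → i ℕ.≤ r′ ℕ.+ r′ → ∀ {t} → t ℕ.< n → digit i (t ℕ.+ M) ≡ t
      old-digit-on-new-block zero    _   t<n = block-% R t<n
      old-digit-on-new-block (suc i) i≤ {t} t<n with blockKind-block i
      ... | inj₁ eq rewrite eq | block-/ R t<n | block-% R t<n | ≢⇒≡ᵇ-false {R} {suc (half i)} (different i≤) = refl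
      ... | inj₂ eq rewrite eq | block-/ R t<n | block-% R t<n | ≢⇒≡ᵇ-false {R} {suc (half i)} (different i≤)
                           | ≢⇒≡ᵇ-false (block-≢0 r′ t) = refl

      cycled-on-new-block : ∀ {t} → t ℕ.< n → digit (suc (r′ ℕ.+ r′)) (t ℕ.+ M) ≡ cycle t
      cycled-on-new-block t<n rewrite blockKind-cycled r′ | block-/ R t<n | block-% R t<n | ≡ᵇ-refl R = refl

      merged-on-new-block : ∀ {t} → t ℕ.< n → digit (suc (suc (r′ ℕ.+ r′))) (t ℕ.+ M) ≡ merge t
      merged-on-new-block {t} t<n rewrite blockKind-merged r′ | block-/ R t<n | block-% R t<n | ≡ᵇ-refl R
                                        | ≢⇒≡ᵇ-false (block-≢0 r′ t) = refl

      cycled-on-old-blocks : ∀ {C} → C ℕ.< M → digit (suc (r′ ℕ.+ r′)) C ≡ digit 0 C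
      cycled-on-old-blocks {C} C<M rewrite blockKind-cycled r′ | ≢⇒≡ᵇ-false {C / n} {R} (ℕₚ.<⇒≢ (DivMod.m<n*o⇒m/o<n C<M)) = refl

      merged-on-old-blocks : ∀ {C} → C ℕ.< M → digit (suc (suc (r′ ℕ.+ r′))) C ≡ (if C ≡ᵇ 0 then 1 else C % n)
      merged-on-old-blocks {C} C<M rewrite blockKind-merged r′ | ≢⇒≡ᵇ-false {C / n} {R} (ℕₚ.<⇒≢ (DivMod.m<n*o⇒m/o<n C<M)) = refl

    cycle-last : cycle (suc n′) ≡ 0
    cycle-last = cong (λ b → if b then 0 else n) (≡ᵇ-refl n)

    cycle-suc : ∀ {t} → t ℕ.< suc n′ → cycle t ≡ suc t
    cycle-suc {t} t<n-1 = cong (λ b → if b then 0 else suc t) (≢⇒≡ᵇ-false (ℕₚ.<⇒≢ (s≤s t<n-1)))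

    ∑-cycle-pick : ∀ c (f : ℕ → ℚ) → suc c ℕ.< n → ∑ℕ n (λ t → δℕ (cycle t) (suc c) * f t) ≡ f c
    ∑-cycle-pick c f (s≤s c<n-1) = begin
      ∑ℕ (suc n′) (λ t → δℕ (cycle t) (suc c) * f t) + δℕ (cycle (suc n′)) (suc c) * f (suc n′)
        ≡⟨ cong₂ _+_ (∑ℕ-cong (suc n′) (λ t t< → cong (λ u → δℕ u (suc c) * f t) (cycle-suc t<)))
                     (cong (λ u → δℕ u (suc c) * f (suc n′)) cycle-last) ⟩
      ∑ℕ (suc n′) (λ t → δℕ t c * f t) + 0ℚ * f (suc n′)
        ≡⟨ cong₂ _+_ (∑ℕ-δ (suc n′) c f c<n-1) (*-zeroˡ (f (suc n′))) ⟩
      f c + 0ℚ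
        ≡⟨ +-identityʳ (f c) ⟩
      f c ∎
      where open ≡-Reasoning

    ∑-cycle-fibre : ∀ c → c ℕ.< n → ∑ℕ n (λ t → δℕ (cycle t) c) ≡ 1ℚ
    ∑-cycle-fibre zero    _   = begin
      ∑ℕ (suc n′) (λ t → δℕ (cycle t) 0) + δℕ (cycle (suc n′)) 0
        ≡⟨ cong₂ _+_ (∑ℕ-cong (suc n′) (λ t t< → cong (λ u → δℕ u 0) (cycle-suc t<))) (cong (λ u → δℕ u 0) cycle-last) ⟩
      ∑ℕ (suc n′) (λ t → 0ℚ) + 1ℚ
        ≡⟨ cong (_+ 1ℚ) (∑ℕ-0 (suc n′)) ⟩
      0ℚ + 1ℚ ∎
      where open ≡-Reasoning
    ∑-cycle-fibre (suc c) 1+c<n = trans (∑ℕ-cong n (λ t _ → sym (*-identityʳ _))) (∑-cycle-pick c (λ _ → 1ℚ) 1+c<n)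

    ∑-merge-0 : ∀ (f : ℕ → ℚ) → ∑ℕ n (λ t → δℕ (merge t) 0 * f t) ≡ f 0 + f 1
    ∑-merge-0 f = begin
      ∑ℕ n (λ t → δℕ (merge t) 0 * f t)                     ≡⟨ ∑ℕ-suc (suc n′) _ ⟩
      1ℚ * f 0 + ∑ℕ (suc n′) (λ t → δℕ (merge (suc t)) 0 * f (suc t)) ≡⟨ cong (1ℚ * f 0 +_) (∑ℕ-suc n′ _) ⟩
      1ℚ * f 0 + (1ℚ * f 1 + ∑ℕ n′ (λ t → 0ℚ * f (2 ℕ.+ t)))   ≡⟨ cong (λ x → 1ℚ * f 0 + (1ℚ * f 1 + x)) (trans (∑ℕ-cong n′ (λ t _ → *-zeroˡ (f (2 ℕ.+ t)))) (∑ℕ-0 n′)) ⟩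
      1ℚ * f 0 + (1ℚ * f 1 + 0ℚ)                             ≡⟨ simplify (f 0) (f 1) ⟩
      f 0 + f 1                                              ∎
      where
      open ≡-Reasoning
      simplify : ∀ a b → 1ℚ * a + (1ℚ * b + 0ℚ) ≡ a + b
      simplify = solve-∀ ℚring

    ∑-merge-fibre : ∀ c → c ℕ.< n → ∑ℕ n (λ t → δℕ (merge t) c) + δℕ 1 c ≡ 1ℚ + δℕ 0 c
    ∑-merge-fibre c c<n = begin
      ∑ℕ n (λ t → δℕ (merge t) c) + δℕ 1 c                                   ≡⟨ cong (_+ δℕ 1 c) (∑ℕ-suc (suc n′) _) ⟩
      (δℕ 0 c + ∑ℕ (suc n′) (λ t → δℕ (merge (suc t)) c)) + δℕ 1 c           ≡⟨ cong (λ x → (δℕ 0 c + x) + δℕ 1 c) (∑ℕ-suc n′ _) ⟩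
      (δℕ 0 c + (δℕ 0 c + ∑ℕ n′ (λ t → δℕ (2 ℕ.+ t) c))) + δℕ 1 c            ≡⟨ cong (λ x → (δℕ 0 c + (δℕ 0 c + x)) + δℕ 1 c) (rest c c<n) ⟩
      (δℕ 0 c + (δℕ 0 c + (1ℚ - (δℕ 0 c + δℕ 1 c)))) + δℕ 1 c                ≡⟨ simplify (δℕ 0 c) (δℕ 1 c) ⟩
      1ℚ + δℕ 0 c                                                            ∎
      where
      open ≡-Reasoning
      simplify : ∀ a b → (a + (a + (1ℚ - (a + b)))) + b ≡ 1ℚ + a
      simplify = solve-∀ ℚring
      rest : ∀ c → c ℕ.< n → ∑ℕ n′ (λ t → δℕ (2 ℕ.+ t) c) ≡ 1ℚ - (δℕ 0 c + δℕ 1 c)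
      rest 0                   _               = trans (∑ℕ-0 n′) (sym (+-inverseʳ 1ℚ))
      rest 1                   _               = trans (∑ℕ-0 n′) (sym (+-inverseʳ 1ℚ))
      rest (suc (suc c)) (s≤s (s≤s c<n′)) = trans (∑ℕ-δ≡1 n′ c c<n′) (sym (trans (cong (λ x → 1ℚ - x) (+-identityʳ 0ℚ)) (ℚ-minus-zero 1ℚ)))
        where
        ℚ-minus-zero : ∀ x → x - 0ℚ ≡ x
        ℚ-minus-zero = solve-∀ ℚring

    ∑ℕ-blocks : ∀ r′ (f : ℕ → ℚ) → ∑ℕ (suc (suc r′) ℕ.* n) f ≡ ∑ℕ (suc r′ ℕ.* n) f + ∑ℕ n (λ t → f (t ℕ.+ suc r′ ℕ.* n))
    ∑ℕ-blocks r′ f = begin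
      ∑ℕ (n ℕ.+ M) f                          ≡⟨ cong (λ k → ∑ℕ k f) (ℕₚ.+-comm n M) ⟩
      ∑ℕ (M ℕ.+ n) f                          ≡⟨ ∑ℕ-+-range M n f ⟩
      ∑ℕ M f + ∑ℕ n (λ t → f (M ℕ.+ t))       ≡⟨ cong (∑ℕ M f +_) (∑ℕ-cong n (λ t _ → cong f (ℕₚ.+-comm M t))) ⟩
      ∑ℕ M f + ∑ℕ n (λ t → f (t ℕ.+ M))       ∎
      where
      open ≡-Reasoning
      M = suc r′ ℕ.* n

    δ-merged-old : ∀ C c → δℕ (if C ≡ᵇ 0 then 1 else C % n) c ≡ δℕ (C % n) c + δℕ C 0 * (δℕ 1 c - δℕ 0 c)
    δ-merged-old zero    c = shift (δℕ 0 c) (δℕ 1 c)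
      where
      shift : ∀ a b → b ≡ a + 1ℚ * (b - a)
      shift = solve-∀ ℚring
    δ-merged-old (suc C) c = sym (trans (cong (δℕ (suc C % n) c +_) (*-zeroˡ (δℕ 1 c - δℕ 0 c))) (+-identityʳ (δℕ (suc C % n) c)))

    digit-kinds : ∀ r′ i → i ℕ.≤ suc r′ ℕ.+ suc r′ →
                  i ℕ.≤ r′ ℕ.+ r′ ⊎ (i ≡ suc (r′ ℕ.+ r′) ⊎ i ≡ suc (suc (r′ ℕ.+ r′)))
    digit-kinds r′ i i≤ with i ℕₚ.≤? r′ ℕ.+ r′ | i ℕₚ.≟ suc (r′ ℕ.+ r′)
    ... | yes old | _       = inj₁ old
    ... | no _    | yes eq  = inj₂ (inj₁ eq)
    ... | no new  | no i≢   = inj₂ (inj₂ (ℕₚ.≤-antisym (subst (i ℕ.≤_) (cong suc (ℕₚ.+-suc r′ r′)) i≤)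
                                                       (ℕₚ.≤∧≢⇒< (ℕₚ.≰⇒> new) (i≢ ∘ sym))))

    digit-fibres : ∀ r′ i → i ℕ.≤ r′ ℕ.+ r′ → ∀ c → c ℕ.< n → ∑ℕ (suc r′ ℕ.* n) (λ C → δℕ (digit i C) c) ≡ fromℕ (suc r′)
    digit-fibres zero zero _ c c<n = begin
      ∑ℕ (n ℕ.+ 0) (λ C → δℕ (C % n) c)   ≡⟨ cong (λ k → ∑ℕ k (λ C → δℕ (C % n) c)) (ℕₚ.+-identityʳ n) ⟩
      ∑ℕ n (λ C → δℕ (C % n) c)            ≡⟨ ∑ℕ-cong n (λ C C<n → cong (λ x → δℕ x c) (DivMod.m<n⇒m%n≡m C<n)) ⟩
      ∑ℕ n (λ C → δℕ C c)                  ≡⟨ ∑ℕ-δ≡1 n c c<n ⟩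
      fromℕ 1                              ∎
      where open ≡-Reasoning
    digit-fibres (suc r′) i i≤ c c<n with digit-kinds r′ i i≤
    ... | inj₁ old = begin
      ∑ℕ (suc (suc r′) ℕ.* n) (λ C → δℕ (digit i C) c)                              ≡⟨ ∑ℕ-blocks r′ (λ C → δℕ (digit i C) c) ⟩
      ∑ℕ M (λ C → δℕ (digit i C) c) + ∑ℕ n (λ t → δℕ (digit i (t ℕ.+ M)) c)          ≡⟨ cong₂ _+_ (digit-fibres r′ i old c c<n)
          (trans (∑ℕ-cong n (λ t t<n → cong (λ x → δℕ x c) (old-digit-on-new-block i old t<n))) (∑ℕ-δ≡1 n c c<n)) ⟩
      fromℕ (suc r′) + 1ℚ                                                          ≡⟨ +-comm (fromℕ (suc r′)) 1ℚ ⟩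
      fromℕ (suc (suc r′))                                                         ∎
      where
      open ≡-Reasoning
      open NewBlock r′
    ... | inj₂ (inj₁ refl) = begin
      ∑ℕ (suc (suc r′) ℕ.* n) (λ C → δℕ (digit i C) c)                              ≡⟨ ∑ℕ-blocks r′ (λ C → δℕ (digit i C) c) ⟩
      ∑ℕ M (λ C → δℕ (digit i C) c) + ∑ℕ n (λ t → δℕ (digit i (t ℕ.+ M)) c)          ≡⟨ cong₂ _+_
          (trans (∑ℕ-cong M (λ C C<M → cong (λ x → δℕ x c) (cycled-on-old-blocks C<M))) (digit-fibres r′ 0 z≤n c c<n))
          (trans (∑ℕ-cong n (λ t t<n → cong (λ x → δℕ x c) (cycled-on-new-block t<n))) (∑-cycle-fibre c c<n)) ⟩
      fromℕ (suc r′) + 1ℚ                                                          ≡⟨ +-comm (fromℕ (suc r′)) 1ℚ ⟩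
      fromℕ (suc (suc r′))                                                         ∎
      where
      open ≡-Reasoning
      open NewBlock r′
    ... | inj₂ (inj₂ refl) = begin
      ∑ℕ (suc (suc r′) ℕ.* n) (λ C → δℕ (digit i C) c)                              ≡⟨ ∑ℕ-blocks r′ (λ C → δℕ (digit i C) c) ⟩
      ∑ℕ M (λ C → δℕ (digit i C) c) + ∑ℕ n (λ t → δℕ (digit i (t ℕ.+ M)) c)          ≡⟨ cong₂ _+_
          (∑ℕ-cong M (λ C C<M → trans (cong (λ x → δℕ x c) (merged-on-old-blocks C<M)) (δ-merged-old C c)))
          (∑ℕ-cong n (λ t t<n → cong (λ x → δℕ x c) (merged-on-new-block t<n))) ⟩
      ∑ℕ M (λ C → δℕ (C % n) c + δℕ C 0 * d) + ∑ℕ n (λ t → δℕ (merge t) c)          ≡⟨ cong (_+ ∑ℕ n (λ t → δℕ (merge t) c)) (∑ℕ-+ M (λ C → δℕ (C % n) c) (λ C → δℕ C 0 * d)) ⟩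
      (∑ℕ M (λ C → δℕ (C % n) c) + ∑ℕ M (λ C → δℕ C 0 * d)) + ∑ℕ n (λ t → δℕ (merge t) c)
        ≡⟨ cong₂ (λ x y → (x + y) + ∑ℕ n (λ t → δℕ (merge t) c)) (digit-fibres r′ 0 z≤n c c<n) (∑ℕ-δ M 0 (λ _ → d) (s≤s z≤n)) ⟩
      (fromℕ (suc r′) + d) + ∑ℕ n (λ t → δℕ (merge t) c)                              ≡⟨ regroup (fromℕ (suc r′)) (δℕ 0 c) (δℕ 1 c) (∑ℕ n (λ t → δℕ (merge t) c)) ⟩
      fromℕ (suc r′) + ((∑ℕ n (λ t → δℕ (merge t) c) + δℕ 1 c) - δℕ 0 c)               ≡⟨ cong (λ x → fromℕ (suc r′) + (x - δℕ 0 c)) (∑-merge-fibre c c<n) ⟩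
      fromℕ (suc r′) + ((1ℚ + δℕ 0 c) - δℕ 0 c)                                       ≡⟨ simplify (fromℕ (suc r′)) (δℕ 0 c) ⟩
      fromℕ (suc (suc r′))                                                         ∎
      where
      open ≡-Reasoning
      open NewBlock r′
      d = δℕ 1 c - δℕ 0 c
      regroup : ∀ F a b S → (F + (b - a)) + S ≡ F + ((S + b) - a)
      regroup = solve-∀ ℚring
      simplify : ∀ F a → F + ((1ℚ + a) - a) ≡ 1ℚ + F
      simplify = solve-∀ ℚring

    UniformDigitMarginals : ℕ → (ℕ → ℚ) → ℚ → Set
    UniformDigitMarginals r′ ℓ K =
      ∀ i → i ℕ.≤ r′ ℕ.+ r′ → ∀ c → c ℕ.< n → ∑ℕ (suc r′ ℕ.* n) (λ C → δℕ (digit i C) c * ℓ C) ≡ K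

    module RigidityStep (r′ : ℕ) (ℓ : ℕ → ℚ) {K : ℚ} (uniform : UniformDigitMarginals (suc r′) ℓ K) where

      open NewBlock r′

      μ : ℚ
      μ = ℓ M

      old : ℕ → ℕ → ℚ
      old i c = ∑ℕ M (λ C → δℕ (digit i C) c * ℓ C)

      split : ∀ i {i≤} c {c<n} → old i c + ∑ℕ n (λ t → δℕ (digit i (t ℕ.+ M)) c * ℓ (t ℕ.+ M)) ≡ K
      split i {i≤} c {c<n} = trans (sym (∑ℕ-blocks r′ (λ C → δℕ (digit i C) c * ℓ C))) (uniform i i≤ c c<n)

      old+new : ∀ i → i ℕ.≤ r′ ℕ.+ r′ → ∀ c → c ℕ.< n → old i c + ℓ (c ℕ.+ M) ≡ K
      old+new i i≤ c c<n = trans (cong (old i c +_) (sym new)) (split i {ℕₚ.≤-trans i≤ (ℕₚ.+-mono-≤ (ℕₚ.n≤1+n r′) (ℕₚ.n≤1+n r′))} c {c<n})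
        where
        new : ∑ℕ n (λ t → δℕ (digit i (t ℕ.+ M)) c * ℓ (t ℕ.+ M)) ≡ ℓ (c ℕ.+ M)
        new = trans (∑ℕ-cong n (λ t t<n → cong (λ x → δℕ x c * ℓ (t ℕ.+ M)) (old-digit-on-new-block i i≤ t<n)))
                    (∑ℕ-δ n c (λ t → ℓ (t ℕ.+ M)) c<n)

      cycled-equation : ∀ c → suc c ℕ.< n → old 0 (suc c) + ℓ (c ℕ.+ M) ≡ K
      cycled-equation c 1+c<n = trans (cong₂ _+_ (sym oldPart) (sym newPart)) (split (suc (r′ ℕ.+ r′)) {iA≤} (suc c) {1+c<n})
        where
        iA≤ : suc (r′ ℕ.+ r′) ℕ.≤ suc r′ ℕ.+ suc r′
        iA≤ = subst (suc (r′ ℕ.+ r′) ℕ.≤_) (cong suc (sym (ℕₚ.+-suc r′ r′))) (ℕₚ.n≤1+n _)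
        oldPart : old (suc (r′ ℕ.+ r′)) (suc c) ≡ old 0 (suc c)
        oldPart = ∑ℕ-cong M (λ C C<M → cong (λ x → δℕ x (suc c) * ℓ C) (cycled-on-old-blocks C<M))
        newPart : ∑ℕ n (λ t → δℕ (digit (suc (r′ ℕ.+ r′)) (t ℕ.+ M)) (suc c) * ℓ (t ℕ.+ M)) ≡ ℓ (c ℕ.+ M)
        newPart = trans (∑ℕ-cong n (λ t t<n → cong (λ x → δℕ x (suc c) * ℓ (t ℕ.+ M)) (cycled-on-new-block t<n)))
                        (∑-cycle-pick c (λ t → ℓ (t ℕ.+ M)) 1+c<n)

      new-block-constant : ∀ t → t ℕ.< n → ℓ (t ℕ.+ M) ≡ μ
      new-block-constant zero    _     = refl
      new-block-constant (suc t) 1+t<n =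
        trans (+-cancelˡ (old 0 (suc t)) _ _ (trans (old+new 0 z≤n (suc t) 1+t<n) (sym (cycled-equation t 1+t<n))))
              (new-block-constant t (ℕₚ.<-trans (ℕₚ.n<1+n t) 1+t<n))

      old-uniform : UniformDigitMarginals r′ ℓ (K - μ)
      old-uniform i i≤ c c<n = begin
        old i c                               ≡⟨ shift (old i c) (ℓ (c ℕ.+ M)) ⟩
        (old i c + ℓ (c ℕ.+ M)) - ℓ (c ℕ.+ M)  ≡⟨ cong₂ _-_ (old+new i i≤ c c<n) (new-block-constant c c<n) ⟩
        K - μ                                 ∎
        where
        open ≡-Reasoning
        shift : ∀ a b → a ≡ (a + b) - b
        shift = solve-∀ ℚring

      first-symbol : ℓ 0 ≡ μ
      first-symbol = begin
        ℓ 0                                            ≡⟨ solve-for (ℓ 0) μ K ⟩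
        (K + μ) - (((K - μ) - ℓ 0) + (μ + μ))           ≡⟨ cong (λ x → (K + μ) - ((x - ℓ 0) + (μ + μ))) (sym (old-uniform 0 z≤n 0 (s≤s z≤n))) ⟩
        (K + μ) - ((old 0 0 - ℓ 0) + (μ + μ))           ≡⟨ cong₂ (λ x y → (K + μ) - (x + y)) (sym oldPart) (sym newPart) ⟩
        (K + μ) - (old iB 0 + ∑ℕ n (λ t → δℕ (digit iB (t ℕ.+ M)) 0 * ℓ (t ℕ.+ M)))  ≡⟨ cong (λ x → (K + μ) - x) (split iB {iB≤} 0 {s≤s z≤n}) ⟩
        (K + μ) - K                                    ≡⟨ cancel K μ ⟩
        μ                                              ∎
        where
        open ≡-Reasoning
        iB = suc (suc (r′ ℕ.+ r′))
        iB≤ : iB ℕ.≤ suc r′ ℕ.+ suc r′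
        iB≤ = subst (iB ℕ.≤_) (cong suc (sym (ℕₚ.+-suc r′ r′))) ℕₚ.≤-refl
        solve-for : ∀ l m K → l ≡ (K + m) - (((K - m) - l) + (m + m))
        solve-for = solve-∀ ℚring
        cancel : ∀ K m → (K + m) - K ≡ m
        cancel = solve-∀ ℚring
        unmerge : ∀ a d l → (a + d * (0ℚ - 1ℚ)) * l ≡ a * l + - (d * l)
        unmerge = solve-∀ ℚring
        oldPart : old iB 0 ≡ old 0 0 - ℓ 0
        oldPart = begin
          old iB 0
            ≡⟨ ∑ℕ-cong M (λ C C<M → trans (cong (λ x → δℕ x 0 * ℓ C) (merged-on-old-blocks C<M))
                                           (trans (cong (_* ℓ C) (δ-merged-old C 0)) (unmerge (δℕ (C % n) 0) (δℕ C 0) (ℓ C)))) ⟩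
          ∑ℕ M (λ C → δℕ (C % n) 0 * ℓ C + - (δℕ C 0 * ℓ C))
            ≡⟨ ∑ℕ-+ M (λ C → δℕ (C % n) 0 * ℓ C) (λ C → - (δℕ C 0 * ℓ C)) ⟩
          old 0 0 + ∑ℕ M (λ C → - (δℕ C 0 * ℓ C))
            ≡⟨ cong (old 0 0 +_) (trans (∑ℕ-neg M (λ C → δℕ C 0 * ℓ C)) (cong -_ (∑ℕ-δ M 0 ℓ (s≤s z≤n)))) ⟩
          old 0 0 - ℓ 0 ∎
        newPart : ∑ℕ n (λ t → δℕ (digit iB (t ℕ.+ M)) 0 * ℓ (t ℕ.+ M)) ≡ μ + μ
        newPart = trans (∑ℕ-cong n (λ t t<n → cong (λ x → δℕ x 0 * ℓ (t ℕ.+ M)) (merged-on-new-block t<n)))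
                        (trans (∑-merge-0 (λ t → ℓ (t ℕ.+ M))) (cong (μ +_) (new-block-constant 1 (s≤s (s≤s z≤n)))))

    digit-rigid : ∀ r′ (ℓ : ℕ → ℚ) {K} → UniformDigitMarginals r′ ℓ K → ∀ C → C ℕ.< suc r′ ℕ.* n → fromℕ (suc r′) * ℓ C ≡ K
    digit-rigid zero ℓ {K} uniform C C<n+0 = begin
      fromℕ 1 * ℓ C                                ≡⟨ one* (ℓ C) ⟩
      ℓ C                                          ≡⟨ sym pick ⟩
      ∑ℕ (n ℕ.+ 0) (λ C′ → δℕ (C′ % n) C * ℓ C′)   ≡⟨ uniform 0 z≤n C C<n ⟩
      K                                            ∎
      where
      open ≡-Reasoning
      one* : ∀ x → (1ℚ + 0ℚ) * x ≡ x
      one* = solve-∀ ℚring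
      C<n : C ℕ.< n
      C<n = subst (C ℕ.<_) (ℕₚ.+-identityʳ n) C<n+0
      pick : ∑ℕ (n ℕ.+ 0) (λ C′ → δℕ (C′ % n) C * ℓ C′) ≡ ℓ C
      pick = trans (cong (λ k → ∑ℕ k (λ C′ → δℕ (C′ % n) C * ℓ C′)) (ℕₚ.+-identityʳ n))
                   (trans (∑ℕ-cong n (λ C′ C′<n → cong (λ x → δℕ x C * ℓ C′) (DivMod.m<n⇒m%n≡m C′<n))) (∑ℕ-δ n C ℓ C<n))
    digit-rigid (suc r′) ℓ {K} uniform C C<N = by-block (C ℕₚ.<? M)
      where
      open NewBlock r′ using (M)
      open RigidityStep r′ ℓ uniform
      IH : ∀ C → C ℕ.< M → fromℕ (suc r′) * ℓ C ≡ K - μ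
      IH = digit-rigid r′ ℓ old-uniform
      Rμ : fromℕ (suc r′) * μ ≡ K - μ
      Rμ = trans (cong (fromℕ (suc r′) *_) (sym first-symbol)) (IH 0 (s≤s z≤n))
      level : fromℕ (suc (suc r′)) * μ ≡ K
      level = trans (distrib (fromℕ (suc r′)) μ) (trans (cong (μ +_) Rμ) (cancel μ K))
        where
        distrib : ∀ R m → (1ℚ + R) * m ≡ m + R * m
        distrib = solve-∀ ℚring
        cancel : ∀ m K → m + (K - m) ≡ K
        cancel = solve-∀ ℚring
      by-block : Dec (C ℕ.< M) → fromℕ (suc (suc r′)) * ℓ C ≡ K
      by-block (yes C<M) = trans (cong (fromℕ (suc (suc r′)) *_) (fromℕ-*-cancelˡ r′ (trans (IH C C<M) (sym Rμ)))) level
      by-block (no C≮M)  = trans (cong (fromℕ (suc (suc r′)) *_) ℓC≡μ) level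
        where
        M≤C : M ℕ.≤ C
        M≤C = ℕₚ.≮⇒≥ C≮M
        t = C ℕ.∸ M
        t+M≡C : t ℕ.+ M ≡ C
        t+M≡C = ℕₚ.m∸n+n≡m M≤C
        ℓC≡μ : ℓ C ≡ μ
        ℓC≡μ = trans (cong ℓ (sym t+M≡C)) (new-block-constant t (ℕₚ.+-cancelʳ-< M t n (subst (ℕ._< n ℕ.+ M) (sym t+M≡C) C<N)))

module ChainEmbedding where

  open import Data.Nat as ℕ using (ℕ; suc; z≤n; s≤s; _^_)
  import Data.Nat.Properties as ℕₚ
  import Data.Nat.Tactic.RingSolver as ℕ-Solver
  open import Data.Fin using (Fin; toℕ; fromℕ<; remQuot; combine)
  open import Data.Fin.Properties using (toℕ<n; toℕ-fromℕ<; remQuot-combine)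
  open import Data.Fin.Patterns using (0F)
  open import Data.List using (List; []; _∷_; map)
  open import Data.List.Properties using (∷-injective)
  open import Data.List.Relation.Unary.All using (All) renaming (tail to All-tail)
  import Data.List.Relation.Unary.All.Properties as All
  open import Data.Product using (Σ; _×_; _,_; proj₁; proj₂; map₂)
  open import Data.Empty using (⊥)
  import Data.Integer as ℤ
  open import Data.Rational using (ℚ; 0ℚ; 1ℚ; _+_; _*_; _-_; -_; _≤_; _<_; _/_)
  open import Data.Rational.Properties
  open import Relation.Binary.PropositionalEquality
  open import Tactic.RingSolver using (solve-∀)

  open RationalArithmetic
  open FiniteSums
  open TupleFamilies
  open DoublingChain
  open DigitCodes

  module EmbeddedChain (n″ r′ : ℕ) where

    open DigitCode (suc n″)

    R K d : ℕ
    R = suc r′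
    K = suc (n″ ℕ.+ r′ ℕ.* n)   -- so that the alphabet size 2 + K of Chain K is R * n by computation
    d = suc (r′ ℕ.+ r′) ℕ.* 3

    open Chain K public using (N)
    open Chain K hiding (N)

    position : Fin d → Fin (suc (r′ ℕ.+ r′)) × Fin 3
    position = remQuot 3

    embed : Triple → Tup n d
    embed s j′ = fromℕ< (digit<n (toℕ (proj₁ (position j′))) (s (proj₂ (position j′))))

    δ-embed : ∀ s j′ c → δ (embed s j′) c ≡ δℕ (digit (toℕ (proj₁ (position j′))) (s (proj₂ (position j′)))) (toℕ c)
    δ-embed s j′ c = trans (δ-toℕ (embed s j′) c) (cong (λ x → δℕ x (toℕ c)) (toℕ-fromℕ< (digit<n (toℕ (proj₁ (position j′))) (s (proj₂ (position j′))))))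

    δ-embed-combine : ∀ s {i} (i≤ : i ℕ.≤ r′ ℕ.+ r′) j {c} (c<n : c ℕ.< n) →
                      δ (embed s (combine (fromℕ< (s≤s i≤)) j)) (fromℕ< c<n) ≡ δℕ (digit i (s j)) c
    δ-embed-combine s {i} i≤ j {c} c<n = begin
      δ (embed s (combine i′ j)) (fromℕ< c<n)
        ≡⟨ δ-embed s (combine i′ j) (fromℕ< c<n) ⟩
      δℕ (digit (toℕ (proj₁ (position (combine i′ j)))) (s (proj₂ (position (combine i′ j))))) (toℕ (fromℕ< c<n))
        ≡⟨ cong (λ p → δℕ (digit (toℕ (proj₁ p)) (s (proj₂ p))) (toℕ (fromℕ< c<n))) (remQuot-combine {k = 3} i′ j) ⟩
      δℕ (digit (toℕ i′) (s j)) (toℕ (fromℕ< c<n))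
        ≡⟨ cong₂ (λ a b → δℕ (digit a (s j)) b) (toℕ-fromℕ< (s≤s i≤)) (toℕ-fromℕ< c<n) ⟩
      δℕ (digit i (s j)) c ∎
      where
      open ≡-Reasoning
      i′ = fromℕ< (s≤s i≤)

    embedded-balanced : Balanced (fromℕ R) (map (map₂ embed) chain)
    embedded-balanced j′ c = begin
      wsum (map (map₂ embed) chain) (λ s → δ (s j′) c)  ≡⟨ wsum-map₂ embed chain (λ s → δ (s j′) c) ⟩
      wsum chain (λ s → δ (embed s j′) c)              ≡⟨ wsum-cong chain (λ s → δ-embed s j′ c) ⟩
      wsum chain (λ s → δℕ (digit i (s j)) (toℕ c))    ≡⟨ chain-uniform j (λ C → δℕ (digit i C) (toℕ c)) ⟩
      ∑ℕ N (λ C → δℕ (digit i C) (toℕ c))              ≡⟨ digit-fibres r′ i (ℕₚ.≤-pred (toℕ<n (proj₁ (position j′)))) (toℕ c) (toℕ<n c) ⟩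
      fromℕ R                                          ∎
      where
      open ≡-Reasoning
      i = toℕ (proj₁ (position j′))
      j = proj₂ (position j′)

    unembed : ∀ (WL : List (ℚ × Tup n d)) (S : List Triple) → map proj₂ WL ≡ map embed S →
              Σ (List (ℚ × Triple)) λ WLᶜ → map proj₂ WLᶜ ≡ S × WL ≡ map (map₂ embed) WLᶜ
    unembed []             []      _  = [] , refl , refl
    unembed ((w , _) ∷ WL) (s ∷ S) eq =
      let (WLᶜ , tuples , WL≡) = unembed WL S (proj₂ (∷-injective eq))
      in (w , s) ∷ WLᶜ , cong (s ∷_) tuples , cong₂ _∷_ (cong (w ,_) (proj₁ (∷-injective eq))) WL≡

    embedded-rigid : ∀ WL K′ → map proj₂ WL ≡ map proj₂ (map (map₂ embed) rest) → 0ℚ < K′ → Balanced K′ WL → ⊥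
    embedded-rigid WL K′ tuples K′>0 balanced =
      rest-rigid WLᶜ (fromℕ R) tuplesᶜ K′>0 (λ j C C<N → digit-rigid r′ (marginal WLᶜ j) (digit-marginals j) C C<N)
      where
      unembedded = unembed WL (map proj₂ rest) (trans tuples (map-proj₂-map₂ embed rest))
      WLᶜ : List (ℚ × Triple)
      WLᶜ = proj₁ unembedded
      tuplesᶜ : map proj₂ WLᶜ ≡ map proj₂ rest
      tuplesᶜ = proj₁ (proj₂ unembedded)
      balancedᶜ : Balanced K′ (map (map₂ embed) WLᶜ)
      balancedᶜ = subst (Balanced K′) (proj₂ (proj₂ unembedded)) balanced
      digit-marginals : ∀ j → UniformDigitMarginals r′ (marginal WLᶜ j) K′
      digit-marginals j i i≤ c c<n = begin
        ∑ℕ N (λ C → δℕ (digit i C) c * marginal WLᶜ j C)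
          ≡⟨ sym (wsum-via-marginal N WLᶜ (transport-tuples WLᶜ tuplesᶜ (All-tail chain-below)) j (λ C → δℕ (digit i C) c)) ⟩
        wsum WLᶜ (λ s → δℕ (digit i (s j)) c)
          ≡⟨ wsum-cong WLᶜ (λ s → sym (δ-embed-combine s i≤ j c<n)) ⟩
        wsum WLᶜ (λ s → δ (embed s j′) (fromℕ< c<n))
          ≡⟨ sym (wsum-map₂ embed WLᶜ (λ s → δ (s j′) (fromℕ< c<n))) ⟩
        load (map (map₂ embed) WLᶜ) j′ (fromℕ< c<n)
          ≡⟨ balancedᶜ j′ (fromℕ< c<n) ⟩
        K′ ∎
        where
        open ≡-Reasoning
        j′ = combine (fromℕ< (s≤s i≤)) j

    T e : ℕ
    T = 2 ^ suc K
    e = N ℕ.* T ℕ.∸ 1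

    NT≥1 : 1 ℕ.≤ N ℕ.* T
    NT≥1 = ℕₚ.*-mono-≤ {1} {N} (s≤s z≤n) (ℕₚ.m^n>0 2 (suc K))

    e≥1 : 1 ℕ.≤ e
    e≥1 = ℕₚ.<⇒≤pred (ℕₚ.≤-trans (s≤s (s≤s z≤n)) (subst (ℕ._≤ N ℕ.* T) (ℕₚ.*-identityʳ N) (ℕₚ.*-monoʳ-≤ N (ℕₚ.m^n>0 2 (suc K)))))

    rest-weight : weight (map (map₂ embed) rest) ≡ fromℕ N - b
    rest-weight = begin
      weight (map (map₂ embed) rest)       ≡⟨ wsum-map₂ embed rest (λ _ → 1ℚ) ⟩
      weight rest                          ≡⟨ shift b (weight rest) ⟩
      (b * 1ℚ + weight rest) - b           ≡⟨ cong (_- b) (trans (chain-uniform 0F (λ _ → 1ℚ)) (trans (∑ℕ-const N 1ℚ) (*-identityʳ (fromℕ N)))) ⟩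
      fromℕ N - b                          ∎
      where
      open ≡-Reasoning
      shift : ∀ b w → w ≡ (b * 1ℚ + w) - b
      shift = solve-∀ ℚring

    scale : ℚ
    scale = fromℕ T * (1ℚ /ℕ e)

    bT≡1 : b * fromℕ T ≡ 1ℚ
    bT≡1 = ½^*2^≡1 (suc K)

    normalised : scale * weight (map (map₂ embed) rest) ≡ 1ℚ
    normalised = begin
      scale * weight (map (map₂ embed) rest)         ≡⟨ cong (scale *_) rest-weight ⟩
      fromℕ T * (1ℚ /ℕ e) * (fromℕ N - b)            ≡⟨ regroup (fromℕ T) (1ℚ /ℕ e) (fromℕ N) b ⟩
      (fromℕ N * fromℕ T - b * fromℕ T) * (1ℚ /ℕ e)  ≡⟨ cong₂ (λ x y → (x - y) * (1ℚ /ℕ e)) (sym (fromℕ-* N T)) bT≡1 ⟩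
      (fromℕ (N ℕ.* T) - 1ℚ) * (1ℚ /ℕ e)             ≡⟨ cong (_* (1ℚ /ℕ e)) (sym (fromℕ-∸ NT≥1)) ⟩
      fromℕ e * (1ℚ /ℕ e)                            ≡⟨ fromℕ*1/ℕ≡1 e≥1 ⟩
      1ℚ                                             ∎
      where
      open ≡-Reasoning
      regroup : ∀ T u N b → T * u * (N - b) ≡ (N * T - b * T) * u
      regroup = solve-∀ ℚring

    scale*b : scale * b ≡ 1ℚ /ℕ e
    scale*b = trans (regroup (fromℕ T) (1ℚ /ℕ e) b) (trans (cong (_* (1ℚ /ℕ e)) bT≡1) (*-identityˡ _))
      where
      regroup : ∀ T u b → T * u * b ≡ (b * T) * u
      regroup = solve-∀ ℚring

    certificate : MarginCertificate (suc (suc n″)) d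
    certificate = record
      { family        = map (map₂ embed) rest
      ; apex          = embed apex
      ; apexWeight    = b
      ; level         = fromℕ R
      ; scale         = scale
      ; family-nonNeg = All.map⁺ rest-nonNeg
      ; balanced      = embedded-balanced
      ; normalised    = normalised
      ; scale-nonNeg  = *-nonNeg (fromℕ-nonNeg T) (1/ℕ-nonNeg e)
      ; rigid         = embedded-rigid
      }

    margin : ∀ {B} → (1ℚ /ℕ e) * (1ℚ /ℕ e) * (fromℕ d * (1ℚ - 1ℚ /ℕ n)) ≤ B → MarginSqAtMost n d B
    margin bound = certificate⇒margin certificate (subst (λ x → x * x * (fromℕ d * (1ℚ - 1ℚ /ℕ n)) ≤ _) (sym scale*b) bound)

  2^-double : ∀ m → 2 ^ (2 ℕ.* m) ≡ 2 ^ m ℕ.* 2 ^ m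
  2^-double m = trans (ℕₚ.^-distribˡ-+-* 2 m (m ℕ.+ 0)) (cong (λ k → 2 ^ m ℕ.* 2 ^ k) (ℕₚ.+-identityʳ m))

  module SingleBlockEstimate (n″ : ℕ) where

    open EmbeddedChain n″ 0

    n : ℕ
    n = suc (suc (suc n″))

    2^n≤e : 2 ^ n ℕ.≤ e
    2^n≤e = ℕₚ.<⇒≤pred (subst (ℕ._< N ℕ.* T) (cong (λ k → 2 ^ suc (suc (suc k))) (ℕₚ.+-identityʳ n″))
                           (ℕₚ.*-monoˡ-< T {{ℕₚ.m^n≢0 2 (suc K)}} {2} {N} (s≤s (s≤s (s≤s z≤n)))))

    bound : 3 ℕ.* 2 ^ (2 ℕ.* n) ℕ.* 1 ℕ.≤ 4 ℕ.* (1 ℕ.* (e ℕ.* e))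
    bound = begin
      3 ℕ.* 2 ^ (2 ℕ.* n) ℕ.* 1           ≡⟨ trans (ℕₚ.*-identityʳ _) (cong (3 ℕ.*_) (2^-double n)) ⟩
      3 ℕ.* (2 ^ n ℕ.* 2 ^ n)             ≤⟨ ℕₚ.*-mono-≤ {3} {4} (s≤s (s≤s (s≤s z≤n))) (ℕₚ.*-mono-≤ 2^n≤e 2^n≤e) ⟩
      4 ℕ.* (e ℕ.* e)                     ≡⟨ cong (4 ℕ.*_) (sym (ℕₚ.*-identityˡ (e ℕ.* e))) ⟩
      4 ℕ.* (1 ℕ.* (e ℕ.* e))             ∎
      where open ℕₚ.≤-Reasoning

  margin-bound-d≡3 : ∀ n → 3 ℕ.≤ n → MarginSqAtMost n 3 ((ℤ.+ 4 / 1) * ½ ^ℕ (2 ℕ.* n))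
  margin-bound-d≡3 1 (s≤s ())
  margin-bound-d≡3 2 (s≤s (s≤s ()))
  margin-bound-d≡3 (suc (suc (suc n″))) _ = margin (≤-trans
    (inverse-square-bound {3} {e} {2 ℕ.* n} {1} {1} {4} {1ℚ - 1ℚ /ℕ n} e≥1 (s≤s z≤n) (s≤s z≤n) (1-1/ℕ≤1 n) bound)
    (≤-reflexive (*-identityʳ _)))
    where
    open EmbeddedChain n″ 0
    open SingleBlockEstimate n″

  module MultiBlockEstimate (n″ r″ : ℕ) where

    open EmbeddedChain n″ (suc r″)

    n r x k Q : ℕ
    n = suc (suc (suc n″))
    r = suc (suc r″)
    x = r ℕ.* (n ℕ.∸ 1)
    k = (n ℕ.∸ 1) ℕ.* (n ℕ.∸ 1) ℕ.* r
    Q = 2 ^ x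

    6r≡3+d : 6 ℕ.* r ≡ 3 ℕ.+ d
    6r≡3+d = six r″
      where
      six : ∀ r″ → 6 ℕ.* suc (suc r″) ≡ 3 ℕ.+ suc (suc r″ ℕ.+ suc r″) ℕ.* 3
      six = ℕ-Solver.solve-∀

    N≡r*n : N ≡ r ℕ.* n
    N≡r*n = blocks n″ r″
      where
      blocks : ∀ n″ r″ → suc (suc (suc (n″ ℕ.+ suc r″ ℕ.* suc (suc (suc n″))))) ≡ suc (suc r″) ℕ.* suc (suc (suc n″))
      blocks = ℕ-Solver.solve-∀

    NQ≤e : N ℕ.* Q ℕ.≤ e
    NQ≤e = ℕₚ.<⇒≤pred (ℕₚ.*-monoʳ-< N (ℕₚ.^-monoʳ-< 2 (s≤s (s≤s z≤n)) x<1+K))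
      where
      exponent : ∀ n″ r″ → suc (suc (n″ ℕ.+ suc r″ ℕ.* suc (suc (suc n″)))) ≡ suc (suc r″) ℕ.* suc (suc n″) ℕ.+ suc r″
      exponent = ℕ-Solver.solve-∀
      x<1+K : x ℕ.< suc K
      x<1+K = subst (x ℕ.<_) (sym (exponent n″ r″)) (ℕₚ.m<m+n x (s≤s z≤n))

    bound : d ℕ.* 2 ^ (2 ℕ.* x) ℕ.* k ℕ.≤ 24 ℕ.* (1 ℕ.* (e ℕ.* e))
    bound = begin
      d ℕ.* 2 ^ (2 ℕ.* x) ℕ.* k                          ≡⟨ cong (λ p → d ℕ.* p ℕ.* k) (2^-double x) ⟩
      d ℕ.* (Q ℕ.* Q) ℕ.* k                              ≤⟨ ℕₚ.*-mono-≤ (ℕₚ.*-monoˡ-≤ (Q ℕ.* Q) d≤6r) k≤nnr ⟩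
      6 ℕ.* r ℕ.* (Q ℕ.* Q) ℕ.* (n ℕ.* n ℕ.* r)          ≡⟨ regroup r n Q ⟩
      6 ℕ.* ((r ℕ.* n ℕ.* Q) ℕ.* (r ℕ.* n ℕ.* Q))        ≡⟨ cong (λ m → 6 ℕ.* ((m ℕ.* Q) ℕ.* (m ℕ.* Q))) (sym N≡r*n) ⟩
      6 ℕ.* ((N ℕ.* Q) ℕ.* (N ℕ.* Q))                    ≤⟨ ℕₚ.*-mono-≤ {6} {24} (ℕₚ.m≤m+n 6 18) (ℕₚ.*-mono-≤ NQ≤e NQ≤e) ⟩
      24 ℕ.* (e ℕ.* e)                                   ≡⟨ cong (24 ℕ.*_) (sym (ℕₚ.*-identityˡ (e ℕ.* e))) ⟩
      24 ℕ.* (1 ℕ.* (e ℕ.* e))                           ∎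
      where
      open ℕₚ.≤-Reasoning
      d≤6r : d ℕ.≤ 6 ℕ.* r
      d≤6r = subst (d ℕ.≤_) (sym 6r≡3+d) (ℕₚ.m≤n+m d 3)
      k≤nnr : k ℕ.≤ n ℕ.* n ℕ.* r
      k≤nnr = ℕₚ.*-monoˡ-≤ r (ℕₚ.*-mono-≤ (ℕₚ.n≤1+n (n ℕ.∸ 1)) (ℕₚ.n≤1+n (n ℕ.∸ 1)))
      regroup : ∀ r n q → 6 ℕ.* r ℕ.* (q ℕ.* q) ℕ.* (n ℕ.* n ℕ.* r) ≡ 6 ℕ.* ((r ℕ.* n ℕ.* q) ℕ.* (r ℕ.* n ℕ.* q))
      regroup = ℕ-Solver.solve-∀

    k≥1 : 1 ℕ.≤ k
    k≥1 = s≤s z≤n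

    24≤4k : 24 ℕ.≤ 4 ℕ.* k
    24≤4k = ℕₚ.≤-trans (ℕₚ.m≤m+n 24 8) (ℕₚ.*-monoʳ-≤ 4 (ℕₚ.*-mono-≤ (ℕₚ.*-mono-≤ {2} {n ℕ.∸ 1} {2} {n ℕ.∸ 1} (s≤s (s≤s z≤n)) (s≤s (s≤s z≤n))) (s≤s (s≤s z≤n))))

  margin-bound-d≡6r∸3 : ∀ n r d → 3 ℕ.≤ n → 2 ℕ.≤ r → d ≡ 6 ℕ.* r ℕ.∸ 3 →
           MarginSqAtMost n d (((ℤ.+ 24 / 1) * ½ ^ℕ (2 ℕ.* (r ℕ.* (n ℕ.∸ 1)))) /ℕ ((n ℕ.∸ 1) ℕ.* (n ℕ.∸ 1) ℕ.* r))
           × (((ℤ.+ 24 / 1) * ½ ^ℕ (2 ℕ.* (r ℕ.* (n ℕ.∸ 1)))) /ℕ ((n ℕ.∸ 1) ℕ.* (n ℕ.∸ 1) ℕ.* r)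
                ≤ (ℤ.+ 4 / 1) * ½ ^ℕ (2 ℕ.* (r ℕ.* (n ℕ.∸ 1))))
           × ((d ℕ.+ 3) ℕ.* (n ℕ.∸ 1) ≡ 6 ℕ.* (r ℕ.* (n ℕ.∸ 1)))
  margin-bound-d≡6r∸3 1 _ _ (s≤s ())
  margin-bound-d≡6r∸3 2 _ _ (s≤s (s≤s ()))
  margin-bound-d≡6r∸3 (suc (suc (suc n″))) 1 _ _ (s≤s ())
  margin-bound-d≡6r∸3 (suc (suc (suc n″))) (suc (suc r″)) _ _ _ refl =
    subst (λ d′ → MarginSqAtMost n d′ B) d≡6r∸3 (margin (≤-trans
      (inverse-square-bound {d} {e} {2 ℕ.* x} {k} {1} {24} {1ℚ - 1ℚ /ℕ n} e≥1 k≥1 (s≤s z≤n) (1-1/ℕ≤1 n) bound)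
      (≤-reflexive (sym (/ℕ≡*1/ℕ ((ℤ.+ 24 / 1) * ½ ^ℕ (2 ℕ.* x)) k≥1))))) ,
    fromℕ*/ℕ-≤ {24} {4} {k} k≥1 (<⇒≤ (½^-pos (2 ℕ.* x))) 24≤4k ,
    trans (cong (ℕ._* (n ℕ.∸ 1)) (ℕₚ.m∸n+n≡m 3≤6r)) (ℕₚ.*-assoc 6 r (n ℕ.∸ 1))
    where
    open EmbeddedChain n″ (suc r″)
    open MultiBlockEstimate n″ r″
    B = ((ℤ.+ 24 / 1) * ½ ^ℕ (2 ℕ.* x)) /ℕ k
    d≡6r∸3 : d ≡ 6 ℕ.* r ℕ.∸ 3
    d≡6r∸3 = sym (trans (cong (ℕ._∸ 3) 6r≡3+d) (ℕₚ.m+n∸m≡n 3 d))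
    3≤6r : 3 ℕ.≤ 6 ℕ.* r
    3≤6r = subst (3 ℕ.≤_) (sym 6r≡3+d) (ℕₚ.m≤m+n 3 d)

open FibonacciFamily using (margin-bound-n≡2)
open ChainEmbedding using (margin-bound-d≡3; margin-bound-d≡6r∸3)

open import Data.Nat using (ℕ; _≤_; _∸_; _+_; _*_)
open import Data.Integer using (+_)
open import Data.Rational using (_/_)
open import Data.Product using (_×_; _,_)
open import Relation.Binary.PropositionalEquality using (_≡_)

theorem2p1 :
    -- (a) n = 2, d ≥ 3 : γ(Ω_{2,d}) ≤ 2^(1-d/2), i.e. γ² ≤ 4·2^(-d)
    ((d : ℕ) → 3 ≤ d →
      MarginSqAtMost 2 d (((+ 4) / 1) Data.Rational.* (½ ^ℕ d)))
    ×
    -- (b) n ≥ 3, d = 3 : γ(Ω_{n,3}) ≤ 2^(1-n), i.e. γ² ≤ 4·2^(-2n)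
    ((n : ℕ) → 3 ≤ n →
      MarginSqAtMost n 3 (((+ 4) / 1) Data.Rational.* (½ ^ℕ (2 * n))))
    ×
    -- (c) n ≥ 3, d = 6r-3, r ≥ 2 :
    -- γ ≤ √6/((n-1)√r)·2^(1-r(n-1)) ≤ 2^(1-r(n-1)) = 2^(1-(d+3)(n-1)/6)
    ((n r d : ℕ) → 3 ≤ n → 2 ≤ r → d ≡ 6 * r ∸ 3 →
      MarginSqAtMost n d
        ((((+ 24) / 1) Data.Rational.* (½ ^ℕ (2 * (r * (n ∸ 1)))))
           /ℕ ((n ∸ 1) * (n ∸ 1) * r))
      ×
      (((((+ 24) / 1) Data.Rational.* (½ ^ℕ (2 * (r * (n ∸ 1)))))
           /ℕ ((n ∸ 1) * (n ∸ 1) * r))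
        Data.Rational.≤ (((+ 4) / 1) Data.Rational.* (½ ^ℕ (2 * (r * (n ∸ 1))))))
      ×
      ((d + 3) * (n ∸ 1) ≡ 6 * (r * (n ∸ 1))))
theorem2p1 = margin-bound-n≡2 , margin-bound-d≡3 , margin-bound-d≡6r∸3
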